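{- A network $N$ is reconstructible from its shortest distance matrix if and only if the subtree reduced version of $N$ is reconstructible from its shortest distance matrix.
   Context: A network on a finite set $X$ with $|X|\ge 2$ is a finite, simple, connected, undirected, unweighted graph with at least two degree-$1$ vertices (leaves), leaves bijectively labelled by $X$, all other vertices of degree $3$; standing assumption: every cut-edge separates $X$ into two non-empty parts and distinct cut-edges induce distinct bipartitions of $X$. A cherry is a pair of leaves with a common neighbour; reducing a cherry $\{x,y\}$ to a leaf $z$ (a new label) means deleting $x,y$ and labelling their common neighbour by $z$. The subtree reduced version of $N$ is the network obtained by repeatedly reducing cherries until none remain (it is unique). $\mathcal{D}_m(N)$ is the matrix of shortest-path distances (number of edges) between leaves; $N$ is reconstructible from it if every network realizing $\mathcal{D}_m(N)$ is isomorphic to $N$ via a leaf-label preserving graph isomorphism. -}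

module Defs where

open import Data.Nat using (ℕ; zero; suc; _≤_)
open import Data.Bool using (Bool; true; false; _∧_; _∨_; not; if_then_else_)
open import Data.Fin using (Fin; _≟_)
open import Data.List using (List; map; allFin)
open import Data.Nat.ListAction using (sum)
open import Data.Product using (Σ; ∃; ∃-syntax; _×_; _,_)
open import Data.Sum using (_⊎_)
open import Relation.Nullary using (¬_)
open import Relation.Nullary.Decidable using (⌊_⌋)
open import Relation.Binary.PropositionalEquality using (_≡_; _≢_)
open import Function.Bundles using (_⇔_)

Adj : ℕ → Set
Adj n = Fin n → Fin n → Bool

data Walk {n : ℕ} (adj : Adj n) : Fin n → Fin n → ℕ → Set where
  here : ∀ {u} → Walk adj u u zero
  step : ∀ {u w v m} → adj u w ≡ true → Walk adj w v m → Walk adj u v (suc m)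

Reach : ∀ {n} → Adj n → Fin n → Fin n → Set
Reach adj u v = ∃[ m ] Walk adj u v m

IsDist : ∀ {n} → Adj n → Fin n → Fin n → ℕ → Set
IsDist adj u v m = Walk adj u v m × (∀ m' → Walk adj u v m' → m ≤ m')

deg : ∀ {n} → Adj n → Fin n → ℕ
deg {n} adj v = sum (map (λ u → if adj v u then 1 else 0) (allFin n))

removeEdge : ∀ {n} → Adj n → Fin n → Fin n → Adj n
removeEdge adj u v a b =
  adj a b ∧ not ((⌊ a ≟ u ⌋ ∧ ⌊ b ≟ v ⌋) ∨ (⌊ a ≟ v ⌋ ∧ ⌊ b ≟ u ⌋))

IsCutEdge : ∀ {n} → Adj n → Fin n → Fin n → Set
IsCutEdge adj u v = adj u v ≡ true × ¬ Reach (removeEdge adj u v) u v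

SamePair : ∀ {n} → Fin n → Fin n → Fin n → Fin n → Set
SamePair u v u' v' = (u ≡ u' × v ≡ v') ⊎ (u ≡ v' × v ≡ u')

-- Networks on the label set X = Fin k with vertex set Fin n.

record Network (k n : ℕ) : Set where
  field
    adj        : Adj n
    sym        : ∀ u v → adj u v ≡ adj v u
    irrefl     : ∀ u → adj u u ≡ false
    connected  : ∀ u v → Reach adj u v
    atLeastTwo : 2 ≤ k
    leaf       : Fin k → Fin n
    leafInj    : ∀ x y → leaf x ≡ leaf y → x ≡ y
    leafDeg    : ∀ v → (deg adj v ≡ 1) ⇔ (∃[ x ] leaf x ≡ v)
    innerDeg   : ∀ v → deg adj v ≢ 1 → deg adj v ≡ 3
    -- every cut-edge separates X into two non-empty parts
    cutNonEmpty : ∀ u v → IsCutEdge adj u v →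
                  (∃[ x ] Reach (removeEdge adj u v) u (leaf x)) ×
                  (∃[ x ] ¬ Reach (removeEdge adj u v) u (leaf x))
    -- distinct cut-edges induce distinct bipartitions of X
    cutDistinct : ∀ u v u' v' → IsCutEdge adj u v → IsCutEdge adj u' v' →
                  ((∀ x → Reach (removeEdge adj u v) u (leaf x)
                          ⇔ Reach (removeEdge adj u' v') u' (leaf x))
                   ⊎ (∀ x → Reach (removeEdge adj u v) u (leaf x)
                          ⇔ (¬ Reach (removeEdge adj u' v') u' (leaf x)))) →
                  SamePair u v u' v'

open Network public

-- D_m(N) as a (functional) relation: DistMatrix N x y m iff the
-- (x,y) entry of D_m(N) is m.
DistMatrix : ∀ {k n} → Network k n → Fin k → Fin k → ℕ → Set
DistMatrix N x y m = IsDist (adj N) (leaf N x) (leaf N y) m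

SameDistMatrix : ∀ {k n n'} → Network k n → Network k n' → Set
SameDistMatrix N N' = ∀ x y m → DistMatrix N x y m ⇔ DistMatrix N' x y m

record Iso {k n n'} (N : Network k n) (N' : Network k n') : Set where
  field
    to      : Fin n → Fin n'
    from    : Fin n' → Fin n
    from∘to : ∀ v → from (to v) ≡ v
    to∘from : ∀ v → to (from v) ≡ v
    adjPres : ∀ u v → adj N u v ≡ adj N' (to u) (to v)
    labPres : ∀ x → to (leaf N x) ≡ leaf N' x

Reconstructible : ∀ {k n} → Network k n → Set
Reconstructible {k} {n} N =
  ∀ {n'} (N' : Network k n') → SameDistMatrix N N' → Iso N N'

IsCherry : ∀ {k n} → Network k n → Fin k → Fin k → Set
IsCherry N x y = x ≢ y ×
  (∃[ p ] (adj N (leaf N x) p ≡ true × adj N (leaf N y) p ≡ true))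

CherryFree : ∀ {k n} → Network k n → Set
CherryFree N = ∀ x y → ¬ IsCherry N x y

-- N' is obtained from N by reducing the cherry {x,y} to a new leaf z:
-- the vertices of N' are (via φ) the vertices of N other than x, y;
-- the common neighbour p becomes the leaf labelled z; all other
-- labels of N' correspond (via σ) to the labels of N other than x, y.
record CherryReduction {k n k' n'} (N : Network k n) (N' : Network k' n') : Set where
  field
    x y   : Fin k
    x≢y   : x ≢ y
    p     : Fin n
    xp    : adj N (leaf N x) p ≡ true
    yp    : adj N (leaf N y) p ≡ true
    φ     : Fin n' → Fin n
    φInj  : ∀ a b → φ a ≡ φ b → a ≡ b
    φImg  : ∀ v → (v ≢ leaf N x × v ≢ leaf N y) ⇔ (∃[ a ] φ a ≡ v)
    φAdj  : ∀ a b → adj N' a b ≡ adj N (φ a) (φ b)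
    z     : Fin k'
    zLeaf : φ (leaf N' z) ≡ p
    σ     : Fin k' → Fin k
    σx    : ∀ a → a ≢ z → σ a ≢ x
    σy    : ∀ a → a ≢ z → σ a ≢ y
    σLeaf : ∀ a → a ≢ z → φ (leaf N' a) ≡ leaf N (σ a)
    σSurj : ∀ b → b ≢ x → b ≢ y → ∃[ a ] (a ≢ z × σ a ≡ b)

data Reduces {k n} (N : Network k n) : ∀ {k' n'} → Network k' n' → Set where
  done : Reduces N N
  more : ∀ {k₁ n₁ k' n'} {N₁ : Network k₁ n₁} {N' : Network k' n'} →
         CherryReduction N N₁ → Reduces N₁ N' → Reduces N N'

IsSubtreeReducedVersion : ∀ {k n k' n'} → Network k n → Network k' n' → Set
IsSubtreeReducedVersion N R = Reduces N R × CherryFree R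

{-# OPTIONS --safe #-}
-- A single cherry reduction N ⇝ N₁ (the cherry {x, y} hanging at p becomes
-- the leaf z) preserves reconstructibility in both directions; the theorem then
-- follows along the reduction sequence.  The two distance matrices determine
-- each other: d_N(σa, σb) = d_N₁(a, b), d_N(x, σb) = d_N₁(z, b) + 1 and
-- d_N(x, y) = 2.  If N is reconstructible and N₁' realises D(N₁), hanging the
-- cherry back at the leaf z of N₁' gives a network realising D(N), hence
-- isomorphic to N, and that isomorphism restricts to N₁ ≅ N₁'.  Conversely, if
-- N' realises D(N) then x and y are at distance 2 in N', so they form a cherry
-- there; reducing it realises D(N₁), and an isomorphism N₁ ≅ N₁' extends to
-- N ≅ N'.  Distances, reachability and cut edges transfer between a graph and
-- the graph with pendant vertices attached, since a walk between old vertices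
-- gains nothing by entering a pendant vertex; this is what makes the attached
-- and detached graphs networks again.

module Submission where

open import Defs hiding (sym)
open import Data.Nat using (ℕ; zero; suc; pred; _+_; _≤_; z≤n; s≤s)
open import Data.Nat.Properties using (≤-trans; ≤-refl; ≤-antisym; ≤-pred; m≤m+n; n≤1+n; +-comm; +-assoc)
open import Data.Bool using (Bool; true; false; _∧_; _∨_; not; if_then_else_)
open import Data.Bool.Properties using (∨-comm; ∧-comm; ∧-zeroʳ; ¬-not; not-¬; not-injective)
open import Data.Fin using (Fin; zero; suc; _≟_; punchIn; punchOut)
open import Data.Fin.Properties using (suc-injective; punchIn-injective; punchInᵢ≢i; punchIn-punchOut)
open import Data.List using (tabulate)
open import Data.List.Properties using (map-tabulate)
open import Data.Nat.ListAction using (sum)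
open import Data.Product using (∃-syntax; _×_; _,_; proj₁; proj₂)
open import Data.Sum using (_⊎_; inj₁; inj₂; map₂)
open import Data.Empty using (⊥-elim)
open import Relation.Nullary using (¬_; yes; no; Dec)
open import Relation.Nullary.Decidable using (⌊_⌋)
open import Relation.Nullary.Reflects using (Reflects; ofʸ; ofⁿ; det; ¬-reflects)
open import Relation.Binary.PropositionalEquality
  using (_≡_; _≢_; refl; sym; trans; cong; cong₂; subst; module ≡-Reasoning)
open import Function using (_∘_; id)
open import Function.Bundles using (_⇔_; mk⇔; module Equivalence)
import Function.Properties.Equivalence as ⇔
open import Function.Related.TypeIsomorphisms using (¬-cong-⇔)

open Equivalence using (to; from)

infixr 5 _⟫_
_⟫_ : ∀ {A B C : Set} → A ⇔ B → B ⇔ C → A ⇔ C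
_⟫_ = ⇔.trans

Reflects-⇔ : ∀ {A B : Set} {b} → A ⇔ B → Reflects A b → Reflects B b
Reflects-⇔ e (ofʸ a) = ofʸ (to e a)
Reflects-⇔ e (ofⁿ ¬a) = ofⁿ (¬a ∘ from e)

≡-from-⇔true : ∀ {a b : Bool} → (a ≡ true ⇔ b ≡ true) → a ≡ b
≡-from-⇔true {true} {true} e = refl
≡-from-⇔true {true} {false} e = sym (to e refl)
≡-from-⇔true {false} {true} e = from e refl
≡-from-⇔true {false} {false} e = refl

another : ∀ {k} → 2 ≤ k → (z : Fin k) → ∃[ a ] a ≢ z
another (s≤s (s≤s _)) zero = suc zero , λ ()
another (s≤s (s≤s _)) (suc z) = zero , λ ()

⌊≟⌋-refl : ∀ {n} (a : Fin n) → ⌊ a ≟ a ⌋ ≡ true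
⌊≟⌋-refl a with a ≟ a
... | yes _ = refl
... | no a≢a = ⊥-elim (a≢a refl)

⌊≟⌋-≢ : ∀ {n} {a b : Fin n} → a ≢ b → ⌊ a ≟ b ⌋ ≡ false
⌊≟⌋-≢ {a = a} {b} a≢b with a ≟ b
... | yes a≡b = ⊥-elim (a≢b a≡b)
... | no _ = refl

indicator : Bool → ℕ
indicator b = if b then 1 else 0

sumFin : ∀ n → (Fin n → ℕ) → ℕ
sumFin n f = sum (tabulate f)

sumFin-punchIn : ∀ n i (f : Fin (suc n) → ℕ) → sumFin (suc n) f ≡ f i + sumFin n (f ∘ punchIn i)
sumFin-punchIn n zero f = refl
sumFin-punchIn (suc n) (suc i) f = begin
  f zero + sumFin (suc n) (f ∘ suc)            ≡⟨ cong (f zero +_) (sumFin-punchIn n i (f ∘ suc)) ⟩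
  f zero + (f (suc i) + rest)                  ≡⟨ sym (+-assoc (f zero) (f (suc i)) rest) ⟩
  f zero + f (suc i) + rest                    ≡⟨ cong (_+ rest) (+-comm (f zero) (f (suc i))) ⟩
  f (suc i) + f zero + rest                    ≡⟨ +-assoc (f (suc i)) (f zero) rest ⟩
  f (suc i) + (f zero + rest)                  ∎
  where
  open ≡-Reasoning
  rest : ℕ
  rest = sumFin n (f ∘ suc ∘ punchIn i)

≤-sumFin : ∀ n (f : Fin n → ℕ) i → f i ≤ sumFin n f
≤-sumFin (suc n) f i rewrite sumFin-punchIn n i f = m≤m+n (f i) _

sumFin-zero : ∀ n (f : Fin n → ℕ) → (∀ i → f i ≡ 0) → sumFin n f ≡ 0
sumFin-zero zero f f≡0 = refl
sumFin-zero (suc n) f f≡0 rewrite f≡0 zero = sumFin-zero n (f ∘ suc) (f≡0 ∘ suc)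

sumFin-indicator-≟ : ∀ n (c : Fin n) → sumFin n (λ a → indicator ⌊ a ≟ c ⌋) ≡ 1
sumFin-indicator-≟ (suc n) c rewrite sumFin-punchIn n c (λ a → indicator ⌊ a ≟ c ⌋) | ⌊≟⌋-refl c =
  cong suc (sumFin-zero n _ (λ j → cong indicator (⌊≟⌋-≢ (punchInᵢ≢i c j))))


SymAdj : ∀ {n} → Adj n → Set
SymAdj G = ∀ a b → G a b ≡ G b a

AtMostOneNeighbour : ∀ {n} → Adj n → Fin n → Set
AtMostOneNeighbour G v = ∀ w w' → G v w ≡ true → G v w' ≡ true → w ≡ w'

deg≡sumFin : ∀ {n} (G : Adj n) v → deg G v ≡ sumFin n (λ u → indicator (G v u))
deg≡sumFin {n} G v = cong sum (map-tabulate id (indicator ∘ G v))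

2≤deg : ∀ {n} (G : Adj n) v a b → a ≢ b → G v a ≡ true → G v b ≡ true → 2 ≤ deg G v
2≤deg {suc n} G v a b a≢b Gva Gvb
  rewrite deg≡sumFin G v | sumFin-punchIn n a (λ u → indicator (G v u)) | Gva =
  s≤s (subst (λ t → indicator t ≤ sumFin n (indicator ∘ G v ∘ punchIn a)) Gvb′
    (≤-sumFin n (indicator ∘ G v ∘ punchIn a) (punchOut a≢b)))
  where
  Gvb′ : G v (punchIn a (punchOut a≢b)) ≡ true
  Gvb′ = trans (cong (G v) (punchIn-punchOut a≢b)) Gvb

deg≡1⇒atMostOneNeighbour : ∀ {n} (G : Adj n) v → deg G v ≡ 1 → AtMostOneNeighbour G v
deg≡1⇒atMostOneNeighbour G v d≡1 a b Gva Gvb with a ≟ b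
... | yes a≡b = a≡b
... | no a≢b with subst (2 ≤_) d≡1 (2≤deg G v a b a≢b Gva Gvb)
...   | s≤s ()

-- Walks, reachability and edge removal
_++ʷ_ : ∀ {n} {G : Adj n} {u v w m m'} → Walk G u v m → Walk G v w m' → Walk G u w (m + m')
here ++ʷ q = q
step e p ++ʷ q = step e (p ++ʷ q)

snocʷ : ∀ {n} {G : Adj n} {u v w m} → Walk G u v m → G v w ≡ true → Walk G u w (suc m)
snocʷ here e = step e here
snocʷ (step e' p) e = step e' (snocʷ p e)

reverseʷ : ∀ {n} {G : Adj n} → SymAdj G → ∀ {u v m} → Walk G u v m → Walk G v u m
reverseʷ G-sym here = here
reverseʷ G-sym (step {u} {w} e p) = snocʷ (reverseʷ G-sym p) (trans (G-sym w u) e)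

mapʷ : ∀ {n n'} {G : Adj n} {H : Adj n'} (f : Fin n → Fin n') → (∀ a b → G a b ≡ true → H (f a) (f b) ≡ true) →
       ∀ {u v m} → Walk G u v m → Walk H (f u) (f v) m
mapʷ f f-adj here = here
mapʷ f f-adj (step e p) = step (f-adj _ _ e) (mapʷ f f-adj p)

Reach-sym : ∀ {n} {G : Adj n} → SymAdj G → ∀ {u v} → Reach G u v → Reach G v u
Reach-sym G-sym (m , p) = m , reverseʷ G-sym p

Reach-trans : ∀ {n} {G : Adj n} {u v w} → Reach G u v → Reach G v w → Reach G u w
Reach-trans (m , p) (m' , q) = m + m' , p ++ʷ q

removeEdge⊆ : ∀ {n} (G : Adj n) u v a b → removeEdge G u v a b ≡ true → G a b ≡ true
removeEdge⊆ G u v a b e with G a b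
... | true = refl

removeEdge-sym : ∀ {n} {G : Adj n} → SymAdj G → ∀ u v → SymAdj (removeEdge G u v)
removeEdge-sym G-sym u v a b = cong₂ _∧_ (G-sym a b)
  (cong not (trans (∨-comm (⌊ a ≟ u ⌋ ∧ ⌊ b ≟ v ⌋) _)
     (cong₂ _∨_ (∧-comm ⌊ a ≟ v ⌋ ⌊ b ≟ u ⌋) (∧-comm ⌊ a ≟ u ⌋ ⌊ b ≟ v ⌋))))

removeEdge-comm : ∀ {n} (G : Adj n) u v a b → removeEdge G u v a b ≡ removeEdge G v u a b
removeEdge-comm G u v a b = cong (λ t → G a b ∧ not t) (∨-comm (⌊ a ≟ u ⌋ ∧ ⌊ b ≟ v ⌋) _)

removeEdge-removed : ∀ {n} (G : Adj n) u v → removeEdge G u v u v ≡ false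
removeEdge-removed G u v rewrite ⌊≟⌋-refl u | ⌊≟⌋-refl v = ∧-zeroʳ (G u v)

removeEdge-≢ˡ : ∀ {n} (G : Adj n) u v a b → a ≢ u → a ≢ v → removeEdge G u v a b ≡ G a b
removeEdge-≢ˡ G u v a b a≢u a≢v rewrite ⌊≟⌋-≢ a≢u | ⌊≟⌋-≢ a≢v with G a b
... | true = refl
... | false = refl

removeEdge-≢ : ∀ {n} (G : Adj n) u v a b → a ≢ v → b ≢ v → removeEdge G u v a b ≡ G a b
removeEdge-≢ G u v a b a≢v b≢v rewrite ⌊≟⌋-≢ a≢v | ⌊≟⌋-≢ b≢v | ∧-zeroʳ ⌊ a ≟ u ⌋ with G a b
... | true = refl
... | false = refl

IsDist-cong : ∀ {n} (G : Adj n) {u u' v v' m} → u ≡ u' → v ≡ v' → IsDist G u v m ⇔ IsDist G u' v' m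
IsDist-cong G refl refl = ⇔.refl

IsDist-sym : ∀ {n} {G : Adj n} → SymAdj G → ∀ {u v m} → IsDist G u v m → IsDist G v u m
IsDist-sym G-sym (p , p-min) = reverseʷ G-sym p , λ m' q → p-min m' (reverseʷ G-sym q)

IsDist-refl⇔ : ∀ {n} (G : Adj n) u m → IsDist G u u m ⇔ m ≡ 0
IsDist-refl⇔ G u m = mk⇔ (λ (_ , p-min) → ≤0 (p-min 0 here)) (λ { refl → here , λ _ _ → z≤n })
  where
  ≤0 : ∀ {a} → a ≤ 0 → a ≡ 0
  ≤0 z≤n = refl

IsDist-zero : ∀ {n} {G : Adj n} {u v} → IsDist G u v 0 → v ≡ u
IsDist-zero (here , _) = refl

module PendantVertex {n} {G : Adj n} (G-sym : SymAdj G) {l q : Fin n}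
                     (l-pendant : AtMostOneNeighbour G l) (lq : G l q ≡ true) where

  reach-via-neighbour : ∀ u → u ≢ l → Reach G u l ⇔ Reach G u q
  reach-via-neighbour u u≢l = mk⇔ forward backward
    where
    forward : Reach G u l → Reach G u q
    forward r with Reach-sym G-sym r
    ... | zero , here = ⊥-elim (u≢l refl)
    ... | suc m , step {_} {w} e p with l-pendant w q e lq
    ... | refl = Reach-sym G-sym (m , p)
    backward : Reach G u q → Reach G u l
    backward (m , p) = suc m , snocʷ p (trans (G-sym q l) lq)

  dist-via-neighbour : ∀ v m → v ≢ l → IsDist G l v (suc m) ⇔ IsDist G q v m
  dist-via-neighbour v m v≢l = mk⇔ forward backward
    where
    forward : IsDist G l v (suc m) → IsDist G q v m
    forward (step {_} {w} e p , p-min) with l-pendant w q e lq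
    ... | refl = p , λ m' p' → ≤-pred (p-min (suc m') (step lq p'))
    backward : IsDist G q v m → IsDist G l v (suc m)
    backward (p , p-min) = step lq p , shortest
      where
      shortest : ∀ m' → Walk G l v m' → suc m ≤ m'
      shortest .0 here = ⊥-elim (v≢l refl)
      shortest (suc m') (step {_} {w} e p') with l-pendant w q e lq
      ... | refl = s≤s (p-min m' p')

  stuck-after-removal : ∀ {w m} → Walk (removeEdge G l q) l w m → w ≡ l
  stuck-after-removal here = refl
  stuck-after-removal (step {_} {w} e p) with l-pendant w q (removeEdge⊆ G l q l w e) lq
  ... | refl with trans (sym e) (removeEdge-removed G l q)
  ... | ()

  ¬Reach-after-removal : q ≢ l → ¬ Reach (removeEdge G q l) q l
  ¬Reach-after-removal q≢l (m , p) =
    q≢l (stuck-after-removal (reverseʷ (removeEdge-sym G-sym l q) (mapʷ id (λ a b e → trans (removeEdge-comm G l q a b) e) p)))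

record PendantExtension {n m} (G : Adj n) (H : Adj m) : Set where
  field
    φ              : Fin m → Fin n
    φInj           : ∀ a b → φ a ≡ φ b → a ≡ b
    φAdj           : ∀ a b → H a b ≡ G (φ a) (φ b)
    G-sym          : SymAdj G
    image⊎pendant  : ∀ v → (∃[ a ] φ a ≡ v) ⊎ AtMostOneNeighbour G v

module _ {n m} {G : Adj n} {H : Adj m} (P : PendantExtension G H) where
  open PendantExtension P

  walk-embed : ∀ {a b k} → Walk H a b k → Walk G (φ a) (φ b) k
  walk-embed = mapʷ φ (λ a b e → trans (sym (φAdj a b)) e)

  -- A walk between image vertices can only leave the image into a pendant
  -- vertex and must return at once to where it came from; cut those detours.
  walk-shortcut : ∀ {u v k} → Walk G u v k → ∀ a b → φ a ≡ u → φ b ≡ v → ∃[ k' ] (k' ≤ k × Walk H a b k')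
  walk-shortcut here a b refl φb≡ with φInj a b (sym φb≡)
  ... | refl = 0 , z≤n , here
  walk-shortcut (step {w = w} e p) a b refl φb≡ with image⊎pendant w
  ... | inj₁ (c , refl) with walk-shortcut p c b refl φb≡
  ...   | k' , k'≤ , q = suc k' , s≤s k'≤ , step (trans (φAdj a c) e) q
  walk-shortcut (step e here) a b refl refl | inj₂ _ = 1 , ≤-refl , step (trans (φAdj a b) e) here
  walk-shortcut (step {u} {w} e (step {_} {_} e₂ p)) a b refl φb≡ | inj₂ w-pendant
    with w-pendant _ u e₂ (trans (G-sym w u) e)
  ... | refl with walk-shortcut p a b refl φb≡
  ...   | k' , k'≤ , q = k' , ≤-trans k'≤ (≤-trans (n≤1+n _) (n≤1+n _)) , q

  Reach-embed⇔ : ∀ a b → Reach H a b ⇔ Reach G (φ a) (φ b)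
  Reach-embed⇔ a b = mk⇔ (λ (k , p) → k , walk-embed p)
                         (λ (k , p) → let (k' , _ , q) = walk-shortcut p a b refl refl in k' , q)

  IsDist-embed⇔ : ∀ a b k → IsDist H a b k ⇔ IsDist G (φ a) (φ b) k
  IsDist-embed⇔ a b k = mk⇔ forward backward
    where
    forward : IsDist H a b k → IsDist G (φ a) (φ b) k
    forward (p , p-min) = walk-embed p ,
      λ k' q → let (k'' , k''≤ , q') = walk-shortcut q a b refl refl in ≤-trans (p-min k'' q') k''≤
    backward : IsDist G (φ a) (φ b) k → IsDist H a b k
    backward (p , p-min) with walk-shortcut p a b refl refl
    ... | k' , k'≤ , q = subst (Walk H a b) (≤-antisym k'≤ (p-min k' (walk-embed q))) q ,
                         λ k'' q' → p-min k'' (walk-embed q')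

  ⌊φ≟φ⌋ : ∀ c a → ⌊ φ c ≟ φ a ⌋ ≡ ⌊ c ≟ a ⌋
  ⌊φ≟φ⌋ c a with c ≟ a
  ... | yes refl = ⌊≟⌋-refl (φ c)
  ... | no c≢a = ⌊≟⌋-≢ (c≢a ∘ φInj c a)

  removeEdge-PendantExtension : ∀ a b → PendantExtension (removeEdge G (φ a) (φ b)) (removeEdge H a b)
  removeEdge-PendantExtension a b = record
    { φ = φ
    ; φInj = φInj
    ; φAdj = λ c d → cong₂ (λ s t → s ∧ not t) (φAdj c d)
        (cong₂ _∨_ (cong₂ _∧_ (sym (⌊φ≟φ⌋ c a)) (sym (⌊φ≟φ⌋ d b)))
                   (cong₂ _∧_ (sym (⌊φ≟φ⌋ c b)) (sym (⌊φ≟φ⌋ d a))))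
    ; G-sym = removeEdge-sym G-sym (φ a) (φ b)
    ; image⊎pendant = λ v → map₂ still-pendant (image⊎pendant v) }
    where
    still-pendant : ∀ {v} → AtMostOneNeighbour G v → AtMostOneNeighbour (removeEdge G (φ a) (φ b)) v
    still-pendant v-pendant w w' e e' = v-pendant w w' (removeEdge⊆ G _ _ _ _ e) (removeEdge⊆ G _ _ _ _ e')

module NetworkFacts {k n} (N : Network k n) where

  leaf-deg≡1 : ∀ c → deg (adj N) (leaf N c) ≡ 1
  leaf-deg≡1 c = from (leafDeg N (leaf N c)) (c , refl)

  leaf-pendant : ∀ c → AtMostOneNeighbour (adj N) (leaf N c)
  leaf-pendant c = deg≡1⇒atMostOneNeighbour (adj N) (leaf N c) (leaf-deg≡1 c)

  adj⇒≢ : ∀ {u v} → adj N u v ≡ true → u ≢ v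
  adj⇒≢ {u} e refl with trans (sym e) (irrefl N u)
  ... | ()

  leaf-≢ : ∀ {c d} → c ≢ d → leaf N c ≢ leaf N d
  leaf-≢ c≢d e = c≢d (leafInj N _ _ e)

  DistMatrix-cong : ∀ {c c' d d' m} → c ≡ c' → d ≡ d' → DistMatrix N c d m ⇔ DistMatrix N c' d' m
  DistMatrix-cong refl refl = ⇔.refl

  DistMatrix-sym : ∀ c d m → DistMatrix N c d m ⇔ DistMatrix N d c m
  DistMatrix-sym c d m = mk⇔ (IsDist-sym (Network.sym N)) (IsDist-sym (Network.sym N))

  DistMatrix-refl⇔ : ∀ c m → DistMatrix N c c m ⇔ m ≡ 0
  DistMatrix-refl⇔ c = IsDist-refl⇔ (adj N) (leaf N c)

module CherryFacts {k n k₁ n₁} {N : Network k n} {N₁ : Network k₁ n₁} (C : CherryReduction N N₁) where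
  open CherryReduction C
  open NetworkFacts N

  lx ly : Fin n
  lx = leaf N x
  ly = leaf N y

  lx≢ly : lx ≢ ly
  lx≢ly = leaf-≢ x≢y

  φ≢lx : ∀ a → φ a ≢ lx
  φ≢lx a = proj₁ (from (φImg (φ a)) (a , refl))

  φ≢ly : ∀ a → φ a ≢ ly
  φ≢ly a = proj₂ (from (φImg (φ a)) (a , refl))

  data VertexView (v : Fin n) : Set where
    is-x : v ≡ lx → VertexView v
    is-y : v ≡ ly → VertexView v
    is-φ : ∀ a → φ a ≡ v → VertexView v

  vertexView : ∀ v → VertexView v
  vertexView v with v ≟ lx
  ... | yes v≡lx = is-x v≡lx
  ... | no v≢lx with v ≟ ly
  ... | yes v≡ly = is-y v≡ly
  ... | no v≢ly = let (a , φa≡v) = to (φImg v) (v≢lx , v≢ly) in is-φ a φa≡v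

  data LabelView (c : Fin k) : Set where
    is-x : c ≡ x → LabelView c
    is-y : c ≡ y → LabelView c
    is-σ : ∀ a → a ≢ z → σ a ≡ c → LabelView c

  labelView : ∀ c → LabelView c
  labelView c with c ≟ x
  ... | yes c≡x = is-x c≡x
  ... | no c≢x with c ≟ y
  ... | yes c≡y = is-y c≡y
  ... | no c≢y = let (a , a≢z , σa≡c) = σSurj c c≢x c≢y in is-σ a a≢z σa≡c

  pendantExtension : PendantExtension (adj N) (adj N₁)
  pendantExtension = record
    { φ = φ ; φInj = φInj ; φAdj = φAdj ; G-sym = Network.sym N ; image⊎pendant = classify }
    where
    classify : ∀ v → (∃[ a ] φ a ≡ v) ⊎ AtMostOneNeighbour (adj N) v
    classify v with vertexView v
    ... | is-x refl = inj₂ (leaf-pendant x)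
    ... | is-y refl = inj₂ (leaf-pendant y)
    ... | is-φ a φa≡v = inj₁ (a , φa≡v)

  σInj : ∀ a b → a ≢ z → b ≢ z → σ a ≡ σ b → a ≡ b
  σInj a b a≢z b≢z e =
    leafInj N₁ a b (φInj _ _ (trans (σLeaf a a≢z) (trans (cong (leaf N) e) (sym (σLeaf b b≢z)))))

  neighbour-x : ∀ w → adj N lx w ≡ true → w ≡ p
  neighbour-x w e = leaf-pendant x w p e xp

  p≢ly : p ≢ ly
  p≢ly e = adj⇒≢ yp (sym e)

  σ-leaf≢lx : ∀ b → b ≢ z → leaf N (σ b) ≢ lx
  σ-leaf≢lx b b≢z = leaf-≢ (σx b b≢z)

  adj-lx-ly : adj N lx ly ≡ false
  adj-lx-ly = ¬-not (λ e → p≢ly (sym (neighbour-x ly e)))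

  adj-lx-φ⇔ : ∀ b → adj N lx (φ b) ≡ true ⇔ b ≡ leaf N₁ z
  adj-lx-φ⇔ b = mk⇔ (λ e → φInj _ _ (trans (neighbour-x (φ b) e) (sym zLeaf)))
                    (λ { refl → subst (λ t → adj N lx t ≡ true) (sym zLeaf) xp })

  module Px = PendantVertex (Network.sym N) (leaf-pendant x) xp
  module Py = PendantVertex (Network.sym N) (leaf-pendant y) yp

  DistMatrix-σσ⇔ : ∀ a b m → a ≢ z → b ≢ z → DistMatrix N₁ a b m ⇔ DistMatrix N (σ a) (σ b) m
  DistMatrix-σσ⇔ a b m a≢z b≢z =
    IsDist-embed⇔ pendantExtension (leaf N₁ a) (leaf N₁ b) m ⟫ IsDist-cong (adj N) (σLeaf a a≢z) (σLeaf b b≢z)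

  DistMatrix-zσ⇔ : ∀ b m → b ≢ z → DistMatrix N₁ z b m ⇔ DistMatrix N x (σ b) (suc m)
  DistMatrix-zσ⇔ b m b≢z =
    IsDist-embed⇔ pendantExtension (leaf N₁ z) (leaf N₁ b) m ⟫ IsDist-cong (adj N) zLeaf (σLeaf b b≢z)
    ⟫ ⇔.sym (Px.dist-via-neighbour (leaf N (σ b)) m (σ-leaf≢lx b b≢z))

  ¬DistMatrix-xσ-0 : ∀ b → b ≢ z → ¬ DistMatrix N x (σ b) 0
  ¬DistMatrix-xσ-0 b b≢z d = σ-leaf≢lx b b≢z (IsDist-zero d)

  DistMatrix-xy⇔ : ∀ m → DistMatrix N x y m ⇔ m ≡ 2
  DistMatrix-xy⇔ m = mk⇔ forward backward
    where
    forward : ∀ {m} → DistMatrix N x y m → m ≡ 2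
    forward {zero} d = ⊥-elim (lx≢ly (sym (IsDist-zero d)))
    forward {suc m} d with IsDist-sym (Network.sym N) (to (Px.dist-via-neighbour ly m (lx≢ly ∘ sym)) d)
    ... | d-ly-p with m
    ... | zero = ⊥-elim (p≢ly (IsDist-zero d-ly-p))
    ... | suc m' = cong (λ t → suc (suc t)) (to (IsDist-refl⇔ (adj N) p m') (to (Py.dist-via-neighbour p m' p≢ly) d-ly-p))
    backward : ∀ {m} → m ≡ 2 → DistMatrix N x y m
    backward refl = from (Px.dist-via-neighbour ly 1 (lx≢ly ∘ sym))
      (IsDist-sym (Network.sym N) (from (Py.dist-via-neighbour p 0 p≢ly) (from (IsDist-refl⇔ (adj N) p 0) refl)))

CherryReduction-swap : ∀ {k n k₁ n₁} {N : Network k n} {N₁ : Network k₁ n₁} →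
                       CherryReduction N N₁ → CherryReduction N N₁
CherryReduction-swap C = record
  { x = y ; y = x ; x≢y = x≢y ∘ sym ; p = p ; xp = yp ; yp = xp
  ; φ = φ ; φInj = φInj
  ; φImg = λ v → mk⇔ (λ (v≢y , v≢x) → to (φImg v) (v≢x , v≢y))
                     (λ e → let (v≢x , v≢y) = from (φImg v) e in v≢y , v≢x)
  ; φAdj = φAdj ; z = z ; zLeaf = zLeaf ; σ = σ ; σx = σy ; σy = σx ; σLeaf = σLeaf
  ; σSurj = λ b b≢y b≢x → σSurj b b≢x b≢y }
  where open CherryReduction C

record SameCherry {k n k₁ n₁ n' n₁'} {N : Network k n} {N₁ : Network k₁ n₁}
                  {N' : Network k n'} {N₁' : Network k₁ n₁'}
                  (C : CherryReduction N N₁) (C' : CherryReduction N' N₁') : Set where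
  field
    x≡ : CherryReduction.x C' ≡ CherryReduction.x C
    y≡ : CherryReduction.y C' ≡ CherryReduction.y C
    z≡ : CherryReduction.z C' ≡ CherryReduction.z C
    σ≡ : ∀ a → CherryReduction.σ C' a ≡ CherryReduction.σ C a

SameCherry-swap : ∀ {k n k₁ n₁ n' n₁'} {N : Network k n} {N₁ : Network k₁ n₁}
                  {N' : Network k n'} {N₁' : Network k₁ n₁'}
                  {C : CherryReduction N N₁} {C' : CherryReduction N' N₁'} →
                  SameCherry C C' → SameCherry (CherryReduction-swap C) (CherryReduction-swap C')
SameCherry-swap same = record { x≡ = y≡ ; y≡ = x≡ ; z≡ = z≡ ; σ≡ = σ≡ }
  where open SameCherry same

module TwoCherries {k n k₁ n₁ n' n₁'} {N : Network k n} {N₁ : Network k₁ n₁}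
                   {N' : Network k n'} {N₁' : Network k₁ n₁'}
                   (C : CherryReduction N N₁) (C' : CherryReduction N' N₁') where
  open CherryReduction C
  module C' = CherryReduction C'
  module A = CherryFacts C
  module B = CherryFacts C'

  module VertexExtension (f : Fin n₁ → Fin n₁') where

    extendAt : ∀ v → A.VertexView v → Fin n'
    extendAt v (A.is-x _) = B.lx
    extendAt v (A.is-y _) = B.ly
    extendAt v (A.is-φ a _) = C'.φ (f a)

    extendAt-irrelevant : ∀ v (w w' : A.VertexView v) → extendAt v w ≡ extendAt v w'
    extendAt-irrelevant v (A.is-x e) (A.is-x e') = refl
    extendAt-irrelevant v (A.is-x e) (A.is-y e') = ⊥-elim (A.lx≢ly (trans (sym e) e'))
    extendAt-irrelevant v (A.is-x e) (A.is-φ a e') = ⊥-elim (A.φ≢lx a (trans e' e))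
    extendAt-irrelevant v (A.is-y e) (A.is-x e') = ⊥-elim (A.lx≢ly (trans (sym e') e))
    extendAt-irrelevant v (A.is-y e) (A.is-y e') = refl
    extendAt-irrelevant v (A.is-y e) (A.is-φ a e') = ⊥-elim (A.φ≢ly a (trans e' e))
    extendAt-irrelevant v (A.is-φ a e) (A.is-x e') = ⊥-elim (A.φ≢lx a (trans e e'))
    extendAt-irrelevant v (A.is-φ a e) (A.is-y e') = ⊥-elim (A.φ≢ly a (trans e e'))
    extendAt-irrelevant v (A.is-φ a e) (A.is-φ a' e') with φInj a a' (trans e (sym e'))
    ... | refl = refl

    extend : Fin n → Fin n'
    extend v = extendAt v (A.vertexView v)

    extend-x : extend A.lx ≡ B.lx
    extend-x = extendAt-irrelevant A.lx (A.vertexView A.lx) (A.is-x refl)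

    extend-y : extend A.ly ≡ B.ly
    extend-y = extendAt-irrelevant A.ly (A.vertexView A.ly) (A.is-y refl)

    extend-φ : ∀ a → extend (φ a) ≡ C'.φ (f a)
    extend-φ a = extendAt-irrelevant (φ a) (A.vertexView (φ a)) (A.is-φ a refl)

  module VertexRestriction (f : Fin n → Fin n') (g : Fin n' → Fin n) (g∘f : ∀ v → g (f v) ≡ v)
                           (f-x : f A.lx ≡ B.lx) (f-y : f A.ly ≡ B.ly) where

    f-injective : ∀ u v → f u ≡ f v → u ≡ v
    f-injective u v e = trans (sym (g∘f u)) (trans (cong g e) (g∘f v))

    preimage : ∀ a → ∃[ b ] C'.φ b ≡ f (φ a)
    preimage a = to (C'.φImg (f (φ a)))
      ( (λ e → A.φ≢lx a (f-injective _ _ (trans e (sym f-x))))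
      , (λ e → A.φ≢ly a (f-injective _ _ (trans e (sym f-y)))) )

    restrict : Fin n₁ → Fin n₁'
    restrict a = proj₁ (preimage a)

    φ-restrict : ∀ a → C'.φ (restrict a) ≡ f (φ a)
    φ-restrict a = proj₂ (preimage a)

  adj-lx-φ-transport : (f : Fin n₁ → Fin n₁') → (∀ a b → f a ≡ f b → a ≡ b) →
                       f (leaf N₁ z) ≡ leaf N₁' C'.z →
                       ∀ b → adj N A.lx (φ b) ≡ adj N' B.lx (C'.φ (f b))
  adj-lx-φ-transport f f-injective f-z b = ≡-from-⇔true
    (A.adj-lx-φ⇔ b ⟫ mk⇔ (λ e → trans (cong f e) f-z) (λ e → f-injective _ _ (trans e (sym f-z)))
                   ⟫ ⇔.sym (B.adj-lx-φ⇔ (f b)))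

module SameCherryFacts {k n k₁ n₁ n' n₁'} {N : Network k n} {N₁ : Network k₁ n₁}
                       {N' : Network k n'} {N₁' : Network k₁ n₁'}
                       {C : CherryReduction N N₁} {C' : CherryReduction N' N₁'} (same : SameCherry C C') where
  open CherryReduction C
  open SameCherry same
  module C' = CherryReduction C'
  module A = CherryFacts C
  module B = CherryFacts C'
  module M = NetworkFacts N
  module M' = NetworkFacts N'
  module M₁ = NetworkFacts N₁
  module M₁' = NetworkFacts N₁'

  ≢z' : ∀ {b} → b ≢ z → b ≢ C'.z
  ≢z' b≢z e = b≢z (trans e z≡)

  SameDistMatrix-reduce-row-z : SameDistMatrix N N' → ∀ b m → b ≢ z → DistMatrix N₁ z b m ⇔ DistMatrix N₁' z b m
  SameDistMatrix-reduce-row-z D≡ b m b≢z =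
    A.DistMatrix-zσ⇔ b m b≢z ⟫ D≡ x (σ b) (suc m) ⟫ M'.DistMatrix-cong (sym x≡) (sym (σ≡ b))
    ⟫ ⇔.sym (B.DistMatrix-zσ⇔ b m (≢z' b≢z)) ⟫ M₁'.DistMatrix-cong z≡ refl

  SameDistMatrix-reduce : SameDistMatrix N N' → SameDistMatrix N₁ N₁'
  SameDistMatrix-reduce D≡ a b m with a ≟ z | b ≟ z
  ... | yes refl | yes refl = M₁.DistMatrix-refl⇔ z m ⟫ ⇔.sym (M₁'.DistMatrix-refl⇔ z m)
  ... | yes refl | no b≢z = SameDistMatrix-reduce-row-z D≡ b m b≢z
  ... | no a≢z | yes refl =
    M₁.DistMatrix-sym a z m ⟫ SameDistMatrix-reduce-row-z D≡ a m a≢z ⟫ M₁'.DistMatrix-sym z a m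
  ... | no a≢z | no b≢z =
    A.DistMatrix-σσ⇔ a b m a≢z b≢z ⟫ D≡ (σ a) (σ b) m ⟫ M'.DistMatrix-cong (sym (σ≡ a)) (sym (σ≡ b))
    ⟫ ⇔.sym (B.DistMatrix-σσ⇔ a b m (≢z' a≢z) (≢z' b≢z))

  SameDistMatrix-row-x : SameDistMatrix N₁ N₁' → ∀ d m → DistMatrix N x d m ⇔ DistMatrix N' x d m
  SameDistMatrix-row-x D≡ d m with A.labelView d
  ... | A.is-x refl = M.DistMatrix-refl⇔ x m ⟫ ⇔.sym (M'.DistMatrix-refl⇔ x m)
  ... | A.is-y refl = A.DistMatrix-xy⇔ m ⟫ ⇔.sym (B.DistMatrix-xy⇔ m) ⟫ M'.DistMatrix-cong x≡ y≡
  ... | A.is-σ b b≢z refl with m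
  ...   | zero = mk⇔ (λ d → ⊥-elim (A.¬DistMatrix-xσ-0 b b≢z d))
                     (λ d → ⊥-elim (B.¬DistMatrix-xσ-0 b (≢z' b≢z) (from (M'.DistMatrix-cong x≡ (σ≡ b)) d)))
  ...   | suc m' = ⇔.sym (A.DistMatrix-zσ⇔ b m' b≢z) ⟫ D≡ z b m' ⟫ M₁'.DistMatrix-cong (sym z≡) refl
                   ⟫ B.DistMatrix-zσ⇔ b m' (≢z' b≢z) ⟫ M'.DistMatrix-cong x≡ (σ≡ b)

SameDistMatrix-expand : ∀ {k n k₁ n₁ n' n₁'} {N : Network k n} {N₁ : Network k₁ n₁}
                        {N' : Network k n'} {N₁' : Network k₁ n₁'}
                        {C : CherryReduction N N₁} {C' : CherryReduction N' N₁'} →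
                        SameCherry C C' → SameDistMatrix N₁ N₁' → SameDistMatrix N N'
SameDistMatrix-expand {N = N} {N' = N'} {C = C} same D≡ c d m
  with CherryFacts.labelView C c | CherryFacts.labelView C d
... | CherryFacts.is-x refl | _ = SameCherryFacts.SameDistMatrix-row-x same D≡ d m
... | CherryFacts.is-y refl | _ = SameCherryFacts.SameDistMatrix-row-x (SameCherry-swap same) D≡ d m
... | CherryFacts.is-σ _ _ refl | CherryFacts.is-x refl =
  NetworkFacts.DistMatrix-sym N _ _ m ⟫ SameCherryFacts.SameDistMatrix-row-x same D≡ _ m
  ⟫ NetworkFacts.DistMatrix-sym N' _ _ m
... | CherryFacts.is-σ _ _ refl | CherryFacts.is-y refl =
  NetworkFacts.DistMatrix-sym N _ _ m ⟫ SameCherryFacts.SameDistMatrix-row-x (SameCherry-swap same) D≡ _ m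
  ⟫ NetworkFacts.DistMatrix-sym N' _ _ m
... | CherryFacts.is-σ a a≢z refl | CherryFacts.is-σ b b≢z refl =
  ⇔.sym (A.DistMatrix-σσ⇔ a b m a≢z b≢z) ⟫ D≡ a b m ⟫ B.DistMatrix-σσ⇔ a b m (≢z' a≢z) (≢z' b≢z)
  ⟫ NetworkFacts.DistMatrix-cong N' (σ≡ a) (σ≡ b)
  where open SameCherry same
        open SameCherryFacts same using (≢z'; module A; module B)

Iso-injective : ∀ {k n n'} {N : Network k n} {N' : Network k n'} (I : Iso N N') → ∀ u v → Iso.to I u ≡ Iso.to I v → u ≡ v
Iso-injective I u v e = trans (sym (I.from∘to u)) (trans (cong I.from e) (I.from∘to v))
  where module I = Iso I

Iso-extend : ∀ {k n k₁ n₁ n' n₁'} {N : Network k n} {N₁ : Network k₁ n₁}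
             {N' : Network k n'} {N₁' : Network k₁ n₁'}
             {C : CherryReduction N N₁} {C' : CherryReduction N' N₁'} →
             SameCherry C C' → Iso N₁ N₁' → Iso N N'
Iso-extend {N = N} {N₁} {N'} {N₁'} {C} {C'} same I = record
  { to = E.extend ; from = E⁻¹.extend ; from∘to = from∘to ; to∘from = to∘from ; adjPres = adjPres ; labPres = labPres }
  where
  open CherryReduction C
  open SameCherry same
  module C' = CherryReduction C'
  module A = CherryFacts C
  module B = CherryFacts C'
  module I = Iso I
  module E = TwoCherries.VertexExtension C C' I.to
  module E⁻¹ = TwoCherries.VertexExtension C' C I.from

  from∘to : ∀ v → E⁻¹.extend (E.extend v) ≡ v
  from∘to v = by-view (A.vertexView v)
    where
    by-view : ∀ {v} → A.VertexView v → E⁻¹.extend (E.extend v) ≡ v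
    by-view (A.is-x refl) = trans (cong E⁻¹.extend E.extend-x) E⁻¹.extend-x
    by-view (A.is-y refl) = trans (cong E⁻¹.extend E.extend-y) E⁻¹.extend-y
    by-view (A.is-φ a refl) = trans (cong E⁻¹.extend (E.extend-φ a)) (trans (E⁻¹.extend-φ (I.to a)) (cong φ (I.from∘to a)))

  to∘from : ∀ v → E.extend (E⁻¹.extend v) ≡ v
  to∘from v = by-view (B.vertexView v)
    where
    by-view : ∀ {v} → B.VertexView v → E.extend (E⁻¹.extend v) ≡ v
    by-view (B.is-x refl) = trans (cong E.extend E⁻¹.extend-x) E.extend-x
    by-view (B.is-y refl) = trans (cong E.extend E⁻¹.extend-y) E.extend-y
    by-view (B.is-φ a refl) = trans (cong E.extend (E⁻¹.extend-φ a)) (trans (E.extend-φ (I.from a)) (cong C'.φ (I.to∘from a)))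

  to-z : I.to (leaf N₁ z) ≡ leaf N₁' C'.z
  to-z = trans (I.labPres z) (cong (leaf N₁') (sym z≡))

  adj-x-φ : ∀ b → adj N A.lx (φ b) ≡ adj N' B.lx (C'.φ (I.to b))
  adj-x-φ = TwoCherries.adj-lx-φ-transport C C' I.to (Iso-injective I) to-z
  adj-y-φ : ∀ b → adj N A.ly (φ b) ≡ adj N' B.ly (C'.φ (I.to b))
  adj-y-φ = TwoCherries.adj-lx-φ-transport (CherryReduction-swap C) (CherryReduction-swap C') I.to (Iso-injective I) to-z

  irrefl≡ : ∀ u u' → adj N u u ≡ adj N' u' u'
  irrefl≡ u u' = trans (irrefl N u) (sym (irrefl N' u'))

  sym≡ : ∀ {u v u' v'} → adj N v u ≡ adj N' v' u' → adj N u v ≡ adj N' u' v'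
  sym≡ e = trans (Network.sym N _ _) (trans e (Network.sym N' _ _))

  adj-transport : ∀ {u v u' v'} → E.extend u ≡ u' → E.extend v ≡ v' → adj N u v ≡ adj N' u' v' →
                  adj N u v ≡ adj N' (E.extend u) (E.extend v)
  adj-transport refl refl e = e

  adjPres : ∀ u v → adj N u v ≡ adj N' (E.extend u) (E.extend v)
  adjPres u v = by-views (A.vertexView u) (A.vertexView v)
    where
    by-views : ∀ {u v} → A.VertexView u → A.VertexView v → adj N u v ≡ adj N' (E.extend u) (E.extend v)
    by-views (A.is-x refl) (A.is-x refl) = adj-transport E.extend-x E.extend-x (irrefl≡ _ _)
    by-views (A.is-x refl) (A.is-y refl) = adj-transport E.extend-x E.extend-y (trans A.adj-lx-ly (sym B.adj-lx-ly))
    by-views (A.is-x refl) (A.is-φ b refl) = adj-transport E.extend-x (E.extend-φ b) (adj-x-φ b)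
    by-views (A.is-y refl) (A.is-x refl) = adj-transport E.extend-y E.extend-x (sym≡ (trans A.adj-lx-ly (sym B.adj-lx-ly)))
    by-views (A.is-y refl) (A.is-y refl) = adj-transport E.extend-y E.extend-y (irrefl≡ _ _)
    by-views (A.is-y refl) (A.is-φ b refl) = adj-transport E.extend-y (E.extend-φ b) (adj-y-φ b)
    by-views (A.is-φ a refl) (A.is-x refl) = adj-transport (E.extend-φ a) E.extend-x (sym≡ (adj-x-φ a))
    by-views (A.is-φ a refl) (A.is-y refl) = adj-transport (E.extend-φ a) E.extend-y (sym≡ (adj-y-φ a))
    by-views (A.is-φ a refl) (A.is-φ b refl) =
      adj-transport (E.extend-φ a) (E.extend-φ b) (trans (sym (φAdj a b)) (trans (I.adjPres a b) (C'.φAdj _ _)))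

  labPres : ∀ c → E.extend (leaf N c) ≡ leaf N' c
  labPres c with A.labelView c
  ... | A.is-x refl = trans E.extend-x (cong (leaf N') x≡)
  ... | A.is-y refl = trans E.extend-y (cong (leaf N') y≡)
  ... | A.is-σ a a≢z refl = begin
    E.extend (leaf N (σ a))     ≡⟨ cong E.extend (sym (σLeaf a a≢z)) ⟩
    E.extend (φ (leaf N₁ a))    ≡⟨ E.extend-φ _ ⟩
    C'.φ (I.to (leaf N₁ a))     ≡⟨ cong C'.φ (I.labPres a) ⟩
    C'.φ (leaf N₁' a)           ≡⟨ C'.σLeaf a (λ e → a≢z (trans e z≡)) ⟩
    leaf N' (C'.σ a)            ≡⟨ cong (leaf N') (σ≡ a) ⟩
    leaf N' (σ a)               ∎
    where open ≡-Reasoning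

Iso-restrict : ∀ {k n k₁ n₁ n' n₁'} {N : Network k n} {N₁ : Network k₁ n₁}
               {N' : Network k n'} {N₁' : Network k₁ n₁'}
               {C : CherryReduction N N₁} {C' : CherryReduction N' N₁'} →
               SameCherry C C' → Iso N N' → Iso N₁ N₁'
Iso-restrict {N = N} {N₁} {N'} {N₁'} {C} {C'} same J = record
  { to = R.restrict ; from = R⁻¹.restrict ; from∘to = from∘to ; to∘from = to∘from ; adjPres = adjPres ; labPres = labPres }
  where
  open CherryReduction C
  open SameCherry same
  module C' = CherryReduction C'
  module A = CherryFacts C
  module B = CherryFacts C'
  module J = Iso J

  to-x : J.to A.lx ≡ B.lx
  to-x = trans (J.labPres x) (cong (leaf N') (sym x≡))
  to-y : J.to A.ly ≡ B.ly
  to-y = trans (J.labPres y) (cong (leaf N') (sym y≡))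
  from-x : J.from B.lx ≡ A.lx
  from-x = trans (cong J.from (sym to-x)) (J.from∘to _)
  from-y : J.from B.ly ≡ A.ly
  from-y = trans (cong J.from (sym to-y)) (J.from∘to _)

  module R = TwoCherries.VertexRestriction C C' J.to J.from J.from∘to to-x to-y
  module R⁻¹ = TwoCherries.VertexRestriction C' C J.from J.to J.to∘from from-x from-y

  from∘to : ∀ a → R⁻¹.restrict (R.restrict a) ≡ a
  from∘to a = φInj _ _ (trans (R⁻¹.φ-restrict (R.restrict a)) (trans (cong J.from (R.φ-restrict a)) (J.from∘to _)))

  to∘from : ∀ a → R.restrict (R⁻¹.restrict a) ≡ a
  to∘from a = C'.φInj _ _ (trans (R.φ-restrict (R⁻¹.restrict a)) (trans (cong J.to (R⁻¹.φ-restrict a)) (J.to∘from _)))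

  adjPres : ∀ a b → adj N₁ a b ≡ adj N₁' (R.restrict a) (R.restrict b)
  adjPres a b = begin
    adj N₁ a b                                   ≡⟨ φAdj a b ⟩
    adj N (φ a) (φ b)                            ≡⟨ J.adjPres _ _ ⟩
    adj N' (J.to (φ a)) (J.to (φ b))             ≡⟨ sym (cong₂ (adj N') (R.φ-restrict a) (R.φ-restrict b)) ⟩
    adj N' (C'.φ (R.restrict a)) (C'.φ (R.restrict b)) ≡⟨ sym (C'.φAdj _ _) ⟩
    adj N₁' (R.restrict a) (R.restrict b)        ∎
    where open ≡-Reasoning

  to-p : J.to p ≡ C'.p
  to-p = B.neighbour-x (J.to p) (trans (cong (λ t → adj N' t (J.to p)) (sym to-x)) (trans (sym (J.adjPres _ _)) xp))

  labPres : ∀ a → R.restrict (leaf N₁ a) ≡ leaf N₁' a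
  labPres a with a ≟ z
  ... | yes refl = C'.φInj _ _ (begin
    C'.φ (R.restrict (leaf N₁ z))   ≡⟨ R.φ-restrict _ ⟩
    J.to (φ (leaf N₁ z))            ≡⟨ cong J.to zLeaf ⟩
    J.to p                          ≡⟨ to-p ⟩
    C'.p                            ≡⟨ sym C'.zLeaf ⟩
    C'.φ (leaf N₁' C'.z)            ≡⟨ cong (C'.φ ∘ leaf N₁') z≡ ⟩
    C'.φ (leaf N₁' z)               ∎)
    where open ≡-Reasoning
  ... | no a≢z = C'.φInj _ _ (begin
    C'.φ (R.restrict (leaf N₁ a))   ≡⟨ R.φ-restrict _ ⟩
    J.to (φ (leaf N₁ a))            ≡⟨ cong J.to (σLeaf a a≢z) ⟩
    J.to (leaf N (σ a))             ≡⟨ J.labPres _ ⟩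
    leaf N' (σ a)                   ≡⟨ cong (leaf N') (sym (σ≡ a)) ⟩
    leaf N' (C'.σ a)                ≡⟨ sym (C'.σLeaf a (λ e → a≢z (trans e z≡))) ⟩
    C'.φ (leaf N₁' a)               ∎)
    where open ≡-Reasoning

-- Cut edges and label bipartitions
SameSplit : ∀ {A : Set} → (A → Set) → (A → Set) → Set
SameSplit P Q = (∀ c → P c ⇔ Q c) ⊎ (∀ c → P c ⇔ (¬ Q c))

Reflects-≡ : ∀ {A B : Set} {s s'} → Reflects A s → Reflects B s' → A ⇔ B → s ≡ s'
Reflects-≡ rA rB A⇔B = det (Reflects-⇔ A⇔B rA) rB

Reflects-≡not : ∀ {A B : Set} {s s'} → Reflects A s → Reflects B s' → A ⇔ (¬ B) → s ≡ not s'
Reflects-≡not rA rB A⇔¬B = det (Reflects-⇔ A⇔¬B rA) (¬-reflects rB)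

module _ {A : Set} {P Q : A → Set} where

  SameSplit-together : SameSplit P Q → ∀ {a b s s'} → P a ⇔ P b → Reflects (Q a) s → Reflects (Q b) s' → s ≡ s'
  SameSplit-together (inj₁ h) Pa⇔Pb rQa rQb =
    Reflects-≡ (Reflects-⇔ (⇔.sym (h _)) rQa) (Reflects-⇔ (⇔.sym (h _)) rQb) Pa⇔Pb
  SameSplit-together (inj₂ h) Pa⇔Pb rQa rQb = not-injective
    (Reflects-≡ (Reflects-⇔ (⇔.sym (h _)) (¬-reflects rQa)) (Reflects-⇔ (⇔.sym (h _)) (¬-reflects rQb)) Pa⇔Pb)

  SameSplit-¬together-apart : SameSplit P Q → ∀ {a b s} → P a ⇔ P b → Reflects (Q a) s → ¬ Reflects (Q b) (not s)
  SameSplit-¬together-apart split Pa⇔Pb rQa rQb = not-¬ refl (SameSplit-together split Pa⇔Pb rQa rQb)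

  SameSplit-¬apart-together : SameSplit P Q → ∀ {a b s} → Reflects (P a) s → Reflects (P b) (not s) → ¬ (Q a ⇔ Q b)
  SameSplit-¬apart-together (inj₁ h) rPa rPb Qa⇔Qb =
    not-¬ refl (Reflects-≡ rPa rPb (h _ ⟫ Qa⇔Qb ⟫ ⇔.sym (h _)))
  SameSplit-¬apart-together (inj₂ h) (ofʸ pa) (ofⁿ ¬pb) Qa⇔Qb =
    ¬pb (from (h _) (λ qb → to (h _) pa (from Qa⇔Qb qb)))
  SameSplit-¬apart-together (inj₂ h) (ofⁿ ¬pa) (ofʸ pb) Qa⇔Qb =
    ¬pa (from (h _) (λ qa → to (h _) pb (to Qa⇔Qb qa)))

Side : ∀ {n k} → Adj n → (Fin k → Fin n) → Fin n → Fin n → Fin k → Set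
Side G l u v c = Reach (removeEdge G u v) u (l c)

SplitsLabels : ∀ {n k} → Adj n → (Fin k → Fin n) → Fin n → Fin n → Set
SplitsLabels G l u v = (∃[ c ] Side G l u v c) × (∃[ c ] ¬ Side G l u v c)

-- A cherry reduction between labelled graphs not yet known to be networks:
-- enough structure to transfer the cut-edge axioms in either direction.
record GraphCherryReduction {n m} (kG kH : ℕ) (G : Adj n) (H : Adj m) : Set where
  field
    extension : PendantExtension G H
    lG : Fin kG → Fin n
    lH : Fin kH → Fin m
    x y : Fin kG
    z : Fin kH
    σ : Fin kH → Fin kG
    p : Fin n
    x-pendant : AtMostOneNeighbour G (lG x)
    y-pendant : AtMostOneNeighbour G (lG y)
    xp : G (lG x) p ≡ true
    yp : G (lG y) p ≡ true
    zLeaf : PendantExtension.φ extension (lH z) ≡ p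
    σLeaf : ∀ a → a ≢ z → PendantExtension.φ extension (lH a) ≡ lG (σ a)
    labelCases : ∀ c → (c ≡ x) ⊎ ((c ≡ y) ⊎ (∃[ a ] (a ≢ z × σ a ≡ c)))
    φ≢x : ∀ a → PendantExtension.φ extension a ≢ lG x
    φ≢y : ∀ a → PendantExtension.φ extension a ≢ lG y

module CutEdgeTransfer {n m kG kH} {G : Adj n} {H : Adj m} (R : GraphCherryReduction kG kH G H) where
  open GraphCherryReduction R
  open PendantExtension extension

  ReachG : Fin m → Fin m → Fin n → Set
  ReachG a b = Reach (removeEdge G (φ a) (φ b)) (φ a)

  ReachH : Fin m → Fin m → Fin m → Set
  ReachH a b = Reach (removeEdge H a b) a

  reach-pendant : ∀ a b {l} → AtMostOneNeighbour G l → G l p ≡ true → (∀ c → φ c ≢ l) →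
                  ReachG a b l ⇔ ReachG a b p
  reach-pendant a b l-pendant lp φ≢l = PendantVertex.reach-via-neighbour
    (removeEdge-sym G-sym (φ a) (φ b))
    (λ w w' e e' → l-pendant w w' (removeEdge⊆ G _ _ _ _ e) (removeEdge⊆ G _ _ _ _ e'))
    (trans (removeEdge-≢ˡ G _ _ _ _ (φ≢l a ∘ sym) (φ≢l b ∘ sym)) lp) (φ a) (φ≢l a)

  reach-embed : ∀ a b d → ReachG a b (φ d) ⇔ ReachH a b d
  reach-embed a b d = ⇔.sym (Reach-embed⇔ (removeEdge-PendantExtension extension a b) a d)

  reach-p : ∀ a b → ReachG a b p ⇔ ReachH a b (lH z)
  reach-p a b = subst (λ t → ReachG a b t ⇔ ReachH a b (lH z)) zLeaf (reach-embed a b (lH z))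

  reach-x : ∀ a b → ReachG a b (lG x) ⇔ ReachH a b (lH z)
  reach-x a b = reach-pendant a b x-pendant xp φ≢x ⟫ reach-p a b

  reach-y : ∀ a b → ReachG a b (lG y) ⇔ ReachH a b (lH z)
  reach-y a b = reach-pendant a b y-pendant yp φ≢y ⟫ reach-p a b

  reach-σ : ∀ a b c → c ≢ z → ReachG a b (lG (σ c)) ⇔ ReachH a b (lH c)
  reach-σ a b c c≢z = subst (λ t → ReachG a b t ⇔ ReachH a b (lH c)) (σLeaf c c≢z) (reach-embed a b (lH c))

  reach-x⇔reach-y : ∀ a b → ReachG a b (lG x) ⇔ ReachG a b (lG y)
  reach-x⇔reach-y a b = reach-x a b ⟫ ⇔.sym (reach-y a b)

  toH : ∀ c → (c ≡ x) ⊎ ((c ≡ y) ⊎ (∃[ a ] (a ≢ z × σ a ≡ c))) → Fin kH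
  toH c (inj₁ _) = z
  toH c (inj₂ (inj₁ _)) = z
  toH c (inj₂ (inj₂ (a , _))) = a

  reach-toH : ∀ a b c case → ReachG a b (lG c) ⇔ ReachH a b (lH (toH c case))
  reach-toH a b c (inj₁ refl) = reach-x a b
  reach-toH a b c (inj₂ (inj₁ refl)) = reach-y a b
  reach-toH a b c (inj₂ (inj₂ (c' , c'≢z , refl))) = reach-σ a b c' c'≢z

  labelToH : Fin kG → Fin kH
  labelToH c = toH c (labelCases c)

  reach-labelToH : ∀ a b c → ReachG a b (lG c) ⇔ ReachH a b (lH (labelToH c))
  reach-labelToH a b c = reach-toH a b c (labelCases c)

  labelToG : Fin kH → Fin kG
  labelToG c with c ≟ z
  ... | yes _ = x
  ... | no _ = σ c

  reach-labelToG : ∀ a b c → ReachH a b (lH c) ⇔ ReachG a b (lG (labelToG c))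
  reach-labelToG a b c with c ≟ z
  ... | yes refl = ⇔.sym (reach-x a b)
  ... | no c≢z = ⇔.sym (reach-σ a b c c≢z)

  IsCutEdge-embed⇔ : ∀ a b → IsCutEdge H a b ⇔ IsCutEdge G (φ a) (φ b)
  IsCutEdge-embed⇔ a b =
    mk⇔ (λ (e , ¬r) → trans (sym (φAdj a b)) e , ¬r ∘ to (reach-embed a b b))
        (λ (e , ¬r) → trans (φAdj a b) e , ¬r ∘ from (reach-embed a b b))

  SamePair-unembed : ∀ {a b a' b'} → SamePair (φ a) (φ b) (φ a') (φ b') → SamePair a b a' b'
  SamePair-unembed (inj₁ (e₁ , e₂)) = inj₁ (φInj _ _ e₁ , φInj _ _ e₂)
  SamePair-unembed (inj₂ (e₁ , e₂)) = inj₂ (φInj _ _ e₁ , φInj _ _ e₂)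

  SamePair-embed : ∀ {a b a' b'} → SamePair a b a' b' → SamePair (φ a) (φ b) (φ a') (φ b')
  SamePair-embed (inj₁ (e₁ , e₂)) = inj₁ (cong φ e₁ , cong φ e₂)
  SamePair-embed (inj₂ (e₁ , e₂)) = inj₂ (cong φ e₁ , cong φ e₂)

  SplitsLabels-toH : ∀ a b → SplitsLabels G lG (φ a) (φ b) → SplitsLabels H lH a b
  SplitsLabels-toH a b ((c , r) , (c' , ¬r)) =
    (labelToH c , to (reach-labelToH a b c) r) , (labelToH c' , ¬r ∘ from (reach-labelToH a b c'))

  SplitsLabels-toG : ∀ a b → SplitsLabels H lH a b → SplitsLabels G lG (φ a) (φ b)
  SplitsLabels-toG a b ((c , r) , (c' , ¬r)) =
    (labelToG c , to (reach-labelToG a b c) r) , (labelToG c' , ¬r ∘ from (reach-labelToG a b c'))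

  SameSplit-toG : ∀ a b a' b' → SameSplit (Side H lH a b) (Side H lH a' b') →
                  SameSplit (Side G lG (φ a) (φ b)) (Side G lG (φ a') (φ b'))
  SameSplit-toG a b a' b' (inj₁ h) =
    inj₁ (λ c → reach-labelToH a b c ⟫ h (labelToH c) ⟫ ⇔.sym (reach-labelToH a' b' c))
  SameSplit-toG a b a' b' (inj₂ h) =
    inj₂ (λ c → reach-labelToH a b c ⟫ h (labelToH c) ⟫ ¬-cong-⇔ (⇔.sym (reach-labelToH a' b' c)))

  SameSplit-toH : ∀ a b a' b' → SameSplit (Side G lG (φ a) (φ b)) (Side G lG (φ a') (φ b')) →
                  SameSplit (Side H lH a b) (Side H lH a' b')
  SameSplit-toH a b a' b' (inj₁ h) =
    inj₁ (λ c → reach-labelToG a b c ⟫ h (labelToG c) ⟫ ⇔.sym (reach-labelToG a' b' c))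
  SameSplit-toH a b a' b' (inj₂ h) =
    inj₂ (λ c → reach-labelToG a b c ⟫ h (labelToG c) ⟫ ¬-cong-⇔ (⇔.sym (reach-labelToG a' b' c)))

-- Attaching a cherry
module AttachCherry {k n k₁ n₁ m} {N : Network k n} {N₁ : Network k₁ n₁}
                    (C : CherryReduction N N₁) (N₁' : Network k₁ m) where
  open CherryReduction C using (x; y; z; σ; x≢y; σx; σy; σSurj)
  module A = CherryFacts C
  H : Adj m
  H = adj N₁'

  pz : Fin m
  pz = leaf N₁' z

  isP : Fin m → Bool
  isP a = ⌊ a ≟ pz ⌋

  isP⇒≡ : ∀ a → isP a ≡ true → a ≡ pz
  isP⇒≡ a e with a ≟ pz
  ... | yes a≡pz = a≡pz

  V : Set
  V = Fin (suc (suc m))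

  -- Vertex 0 carries x, vertex 1 carries y, and vertex a of N₁' becomes 2 + a.
  old : Fin m → V
  old a = suc (suc a)

  P : V
  P = old pz

  G : Adj (suc (suc m))
  G zero zero = false
  G zero (suc zero) = false
  G zero (suc (suc a)) = isP a
  G (suc zero) zero = false
  G (suc zero) (suc zero) = false
  G (suc zero) (suc (suc a)) = isP a
  G (suc (suc a)) zero = isP a
  G (suc (suc a)) (suc zero) = isP a
  G (suc (suc a)) (suc (suc b)) = H a b

  G-sym : SymAdj G
  G-sym zero zero = refl
  G-sym zero (suc zero) = refl
  G-sym zero (suc (suc b)) = refl
  G-sym (suc zero) zero = refl
  G-sym (suc zero) (suc zero) = refl
  G-sym (suc zero) (suc (suc b)) = refl
  G-sym (suc (suc a)) zero = refl
  G-sym (suc (suc a)) (suc zero) = refl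
  G-sym (suc (suc a)) (suc (suc b)) = Network.sym N₁' a b

  G-irrefl : ∀ a → G a a ≡ false
  G-irrefl zero = refl
  G-irrefl (suc zero) = refl
  G-irrefl (suc (suc a)) = irrefl N₁' a

  neighbour-0 : ∀ w → G zero w ≡ true → w ≡ P
  neighbour-0 (suc (suc a)) e = cong old (isP⇒≡ a e)

  neighbour-1 : ∀ w → G (suc zero) w ≡ true → w ≡ P
  neighbour-1 (suc (suc a)) e = cong old (isP⇒≡ a e)

  0-pendant : AtMostOneNeighbour G zero
  0-pendant w w' e e' = trans (neighbour-0 w e) (sym (neighbour-0 w' e'))

  1-pendant : AtMostOneNeighbour G (suc zero)
  1-pendant w w' e e' = trans (neighbour-1 w e) (sym (neighbour-1 w' e'))

  0-P : G zero P ≡ true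
  0-P = ⌊≟⌋-refl pz

  1-P : G (suc zero) P ≡ true
  1-P = ⌊≟⌋-refl pz

  deg-0 : deg G zero ≡ 1
  deg-0 = trans (deg≡sumFin G zero) (sumFin-indicator-≟ m pz)

  deg-1 : deg G (suc zero) ≡ 1
  deg-1 = trans (deg≡sumFin G (suc zero)) (sumFin-indicator-≟ m pz)

  deg-old : ∀ a → deg G (old a) ≡ indicator (isP a) + (indicator (isP a) + deg H a)
  deg-old a = trans (deg≡sumFin G (old a)) (cong (λ t → indicator (isP a) + (indicator (isP a) + t)) (sym (deg≡sumFin H a)))

  deg-P : deg G P ≡ 3
  deg-P rewrite deg-old pz | ⌊≟⌋-refl pz | NetworkFacts.leaf-deg≡1 N₁' z = refl

  deg-old-≢P : ∀ a → a ≢ pz → deg G (old a) ≡ deg H a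
  deg-old-≢P a a≢pz rewrite deg-old a | ⌊≟⌋-≢ a≢pz = refl

  leafAt : ∀ c → A.LabelView c → V
  leafAt c (A.is-x _) = zero
  leafAt c (A.is-y _) = suc zero
  leafAt c (A.is-σ a _ _) = old (leaf N₁' a)

  leafAt-irrelevant : ∀ c (w w' : A.LabelView c) → leafAt c w ≡ leafAt c w'
  leafAt-irrelevant c (A.is-x e) (A.is-x e') = refl
  leafAt-irrelevant c (A.is-x e) (A.is-y e') = ⊥-elim (x≢y (trans (sym e) e'))
  leafAt-irrelevant c (A.is-x e) (A.is-σ a a≢z e') = ⊥-elim (σx a a≢z (trans e' e))
  leafAt-irrelevant c (A.is-y e) (A.is-x e') = ⊥-elim (x≢y (trans (sym e') e))
  leafAt-irrelevant c (A.is-y e) (A.is-y e') = refl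
  leafAt-irrelevant c (A.is-y e) (A.is-σ a a≢z e') = ⊥-elim (σy a a≢z (trans e' e))
  leafAt-irrelevant c (A.is-σ a a≢z e) (A.is-x e') = ⊥-elim (σx a a≢z (trans e e'))
  leafAt-irrelevant c (A.is-σ a a≢z e) (A.is-y e') = ⊥-elim (σy a a≢z (trans e e'))
  leafAt-irrelevant c (A.is-σ a a≢z e) (A.is-σ a' a'≢z e') with A.σInj a a' a≢z a'≢z (trans e (sym e'))
  ... | refl = refl

  lf : Fin k → V
  lf c = leafAt c (A.labelView c)

  lf-x : lf x ≡ zero
  lf-x = leafAt-irrelevant _ (A.labelView _) (A.is-x refl)

  lf-y : lf y ≡ suc zero
  lf-y = leafAt-irrelevant _ (A.labelView _) (A.is-y refl)

  lf-σ : ∀ a → a ≢ z → lf (σ a) ≡ old (leaf N₁' a)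
  lf-σ a a≢z = leafAt-irrelevant _ (A.labelView _) (A.is-σ a a≢z refl)

  old-injective : ∀ a b → old a ≡ old b → a ≡ b
  old-injective a b = suc-injective ∘ suc-injective

  leafAt-injective : ∀ c d (wc : A.LabelView c) (wd : A.LabelView d) → leafAt c wc ≡ leafAt d wd → c ≡ d
  leafAt-injective c d (A.is-x e₁) (A.is-x e₂) e = trans e₁ (sym e₂)
  leafAt-injective c d (A.is-y e₁) (A.is-y e₂) e = trans e₁ (sym e₂)
  leafAt-injective c d (A.is-σ a _ e₁) (A.is-σ b _ e₂) e with leafInj N₁' a b (old-injective _ _ e)
  ... | refl = trans (sym e₁) e₂

  lf-injective : ∀ c d → lf c ≡ lf d → c ≡ d
  lf-injective c d = leafAt-injective c d (A.labelView c) (A.labelView d)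

  leafAt≢P : ∀ c (w : A.LabelView c) → leafAt c w ≢ P
  leafAt≢P c (A.is-σ a a≢z _) e = a≢z (leafInj N₁' a z (old-injective _ _ e))

  leafAt-old : ∀ c a (w : A.LabelView c) → leafAt c w ≡ old a → ∃[ c' ] leaf N₁' c' ≡ a
  leafAt-old c a (A.is-σ a' _ _) e = a' , old-injective _ _ e

  lf-deg : ∀ v → (deg G v ≡ 1) ⇔ (∃[ c ] lf c ≡ v)
  lf-deg zero = mk⇔ (λ _ → x , lf-x) (λ _ → deg-0)
  lf-deg (suc zero) = mk⇔ (λ _ → y , lf-y) (λ _ → deg-1)
  lf-deg (suc (suc a)) = by-cases (a ≟ pz)
    where
    by-cases : Dec (a ≡ pz) → (deg G (old a) ≡ 1) ⇔ (∃[ c ] lf c ≡ old a)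
    by-cases (yes refl) = mk⇔ (λ d → ⊥-elim (3≢1 (trans (sym deg-P) d)))
                              (λ (c , e) → ⊥-elim (leafAt≢P c (A.labelView c) e))
      where
      3≢1 : 3 ≢ 1
      3≢1 ()
    by-cases (no a≢pz) = mk⇔ forward backward
      where
      forward : deg G (old a) ≡ 1 → ∃[ c ] lf c ≡ old a
      forward d with to (leafDeg N₁' a) (trans (sym (deg-old-≢P a a≢pz)) d)
      ... | c' , refl = σ c' , lf-σ c' (λ { refl → a≢pz refl })
      backward : ∃[ c ] lf c ≡ old a → deg G (old a) ≡ 1
      backward (c , e) = trans (deg-old-≢P a a≢pz) (from (leafDeg N₁' a) (leafAt-old c a (A.labelView c) e))

  inner-deg : ∀ v → deg G v ≢ 1 → deg G v ≡ 3
  inner-deg zero d≢1 = ⊥-elim (d≢1 deg-0)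
  inner-deg (suc zero) d≢1 = ⊥-elim (d≢1 deg-1)
  inner-deg (suc (suc a)) = by-cases (a ≟ pz)
    where
    by-cases : Dec (a ≡ pz) → deg G (old a) ≢ 1 → deg G (old a) ≡ 3
    by-cases (yes refl) _ = deg-P
    by-cases (no a≢pz) d≢1 = trans (deg-old-≢P a a≢pz) (innerDeg N₁' a (d≢1 ∘ trans (deg-old-≢P a a≢pz)))

  reach-P : ∀ u → Reach G u P
  reach-P zero = 1 , step 0-P here
  reach-P (suc zero) = 1 , step 1-P here
  reach-P (suc (suc a)) = let (j , w) = connected N₁' a pz in j , mapʷ old (λ _ _ e → e) w

  G-connected : ∀ u v → Reach G u v
  G-connected u v = Reach-trans (reach-P u) (Reach-sym G-sym (reach-P v))

  extension : PendantExtension G H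
  extension = record
    { φ = old ; φInj = old-injective ; φAdj = λ a b → refl ; G-sym = G-sym ; image⊎pendant = classify }
    where
    classify : ∀ v → (∃[ a ] old a ≡ v) ⊎ AtMostOneNeighbour G v
    classify zero = inj₂ 0-pendant
    classify (suc zero) = inj₂ 1-pendant
    classify (suc (suc a)) = inj₁ (a , refl)

  labelCases : ∀ c → A.LabelView c → (c ≡ x) ⊎ ((c ≡ y) ⊎ (∃[ a ] (a ≢ z × σ a ≡ c)))
  labelCases c (A.is-x e) = inj₁ e
  labelCases c (A.is-y e) = inj₂ (inj₁ e)
  labelCases c (A.is-σ a a≢z e) = inj₂ (inj₂ (a , a≢z , e))

  old≢0 : ∀ {a} {v : V} → v ≡ zero → old a ≢ v
  old≢0 refl ()

  old≢1 : ∀ {a} {v : V} → v ≡ suc zero → old a ≢ v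
  old≢1 refl ()

  graphReduction : GraphCherryReduction k k₁ G H
  graphReduction = record
    { extension = extension ; lG = lf ; lH = leaf N₁' ; x = x ; y = y ; z = z ; σ = σ ; p = P
    ; x-pendant = subst (AtMostOneNeighbour G) (sym lf-x) 0-pendant
    ; y-pendant = subst (AtMostOneNeighbour G) (sym lf-y) 1-pendant
    ; xp = subst (λ t → G t P ≡ true) (sym lf-x) 0-P
    ; yp = subst (λ t → G t P ≡ true) (sym lf-y) 1-P
    ; zLeaf = refl
    ; σLeaf = λ a a≢z → sym (lf-σ a a≢z)
    ; labelCases = λ c → labelCases c (A.labelView c)
    ; φ≢x = λ a → old≢0 lf-x
    ; φ≢y = λ a → old≢1 lf-y }

  module T = CutEdgeTransfer graphReduction

  w : Fin k
  w = σ (proj₁ (another (atLeastTwo N₁') z))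

  lf-w : lf w ≡ old (leaf N₁' (proj₁ (another (atLeastTwo N₁') z)))
  lf-w = lf-σ _ (proj₂ (another (atLeastTwo N₁') z))

  data PendantEdge : Set where
    x-P P-x y-P P-y : PendantEdge

  source target : PendantEdge → V
  source x-P = zero
  source P-x = P
  source y-P = suc zero
  source P-y = P
  target x-P = P
  target P-x = zero
  target y-P = P
  target P-y = suc zero

  x-side w-side : PendantEdge → Bool
  x-side x-P = true
  x-side P-x = false
  x-side y-P = false
  x-side P-y = true
  w-side x-P = false
  w-side P-x = true
  w-side y-P = false
  w-side P-y = true

  PendantSide : PendantEdge → Fin k → Set
  PendantSide t = Side G lf (source t) (target t)

  ¬side-from-leaf : ∀ {l} → AtMostOneNeighbour G l → G l P ≡ true → ∀ c → lf c ≢ l → ¬ Side G lf l P c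
  ¬side-from-leaf l-pendant lP c lf≢l (_ , walk) = lf≢l (PendantVertex.stuck-after-removal G-sym l-pendant lP walk)

  side-from-leaf : ∀ {l} c → lf c ≡ l → Side G lf l P c
  side-from-leaf c refl = 0 , here

  ¬side-from-P : ∀ {l} → AtMostOneNeighbour G l → G l P ≡ true → P ≢ l → ∀ c → lf c ≡ l → ¬ Side G lf P l c
  ¬side-from-P l-pendant lP P≢l c refl = PendantVertex.¬Reach-after-removal G-sym l-pendant lP P≢l

  reach-old-from-P : ∀ {l} → (∀ a → old a ≢ l) → ∀ d → Reach (removeEdge G P l) P (old d)
  reach-old-from-P old≢l d = let (j , walk) = connected N₁' pz d in
    j , mapʷ old (λ a b e → trans (removeEdge-≢ G P _ (old a) (old b) (old≢l a) (old≢l b)) e) walk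

  reach-neighbour-from-P : ∀ {l l'} → P ≢ l → l' ≢ l → G P l' ≡ true → Reach (removeEdge G P l) P l'
  reach-neighbour-from-P P≢l l'≢l e = 1 , step (trans (removeEdge-≢ G P _ P _ P≢l l'≢l) e) here

  0≢1 : _≢_ {A = V} zero (suc zero)
  0≢1 ()

  reflects-x : ∀ t → Reflects (PendantSide t x) (x-side t)
  reflects-x x-P = ofʸ (side-from-leaf x lf-x)
  reflects-x P-x = ofⁿ (¬side-from-P 0-pendant 0-P (λ ()) x lf-x)
  reflects-x y-P = ofⁿ (¬side-from-leaf 1-pendant 1-P x (0≢1 ∘ trans (sym lf-x)))
  reflects-x P-y = ofʸ (subst (Reach _ P) (sym lf-x) (reach-neighbour-from-P (λ ()) 0≢1 (trans (G-sym P zero) 0-P)))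

  reflects-y : ∀ t → Reflects (PendantSide t y) (not (x-side t))
  reflects-y x-P = ofⁿ (¬side-from-leaf 0-pendant 0-P y (0≢1 ∘ sym ∘ trans (sym lf-y)))
  reflects-y P-x =
    ofʸ (subst (Reach _ P) (sym lf-y) (reach-neighbour-from-P (λ ()) (0≢1 ∘ sym) (trans (G-sym P (suc zero)) 1-P)))
  reflects-y y-P = ofʸ (side-from-leaf y lf-y)
  reflects-y P-y = ofⁿ (¬side-from-P 1-pendant 1-P (λ ()) y lf-y)

  reflects-w : ∀ t → Reflects (PendantSide t w) (w-side t)
  reflects-w x-P = ofⁿ (¬side-from-leaf 0-pendant 0-P w (old≢0 refl ∘ trans (sym lf-w)))
  reflects-w P-x = ofʸ (subst (Reach _ P) (sym lf-w) (reach-old-from-P (λ a → old≢0 refl) _))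
  reflects-w y-P = ofⁿ (¬side-from-leaf 1-pendant 1-P w (old≢1 refl ∘ trans (sym lf-w)))
  reflects-w P-y = ofʸ (subst (Reach _ P) (sym lf-w) (reach-old-from-P (λ a → old≢1 refl) _))

  -- The sides of x and w tell the four pendant edges and their orientations apart.
  same-sides⇒same-edge : ∀ t t' → x-side t ≡ x-side t' → w-side t ≡ w-side t' →
                          SamePair (source t) (target t) (source t') (target t')
  same-sides⇒same-edge x-P x-P _ _ = inj₁ (refl , refl)
  same-sides⇒same-edge P-x P-x _ _ = inj₁ (refl , refl)
  same-sides⇒same-edge y-P y-P _ _ = inj₁ (refl , refl)
  same-sides⇒same-edge P-y P-y _ _ = inj₁ (refl , refl)
  same-sides⇒same-edge x-P P-x () _
  same-sides⇒same-edge x-P y-P () _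
  same-sides⇒same-edge x-P P-y _ ()
  same-sides⇒same-edge P-x x-P () _
  same-sides⇒same-edge P-x y-P _ ()
  same-sides⇒same-edge P-x P-y () _
  same-sides⇒same-edge y-P x-P () _
  same-sides⇒same-edge y-P P-x _ ()
  same-sides⇒same-edge y-P P-y () _
  same-sides⇒same-edge P-y x-P _ ()
  same-sides⇒same-edge P-y P-x () _
  same-sides⇒same-edge P-y y-P () _

  opposite-sides⇒same-edge : ∀ t t' → x-side t ≡ not (x-side t') → w-side t ≡ not (w-side t') →
                              SamePair (source t) (target t) (source t') (target t')
  opposite-sides⇒same-edge x-P P-x _ _ = inj₂ (refl , refl)
  opposite-sides⇒same-edge P-x x-P _ _ = inj₂ (refl , refl)
  opposite-sides⇒same-edge y-P P-y _ _ = inj₂ (refl , refl)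
  opposite-sides⇒same-edge P-y y-P _ _ = inj₂ (refl , refl)
  opposite-sides⇒same-edge x-P x-P () _
  opposite-sides⇒same-edge x-P y-P _ ()
  opposite-sides⇒same-edge x-P P-y () _
  opposite-sides⇒same-edge P-x P-x () _
  opposite-sides⇒same-edge P-x y-P () _
  opposite-sides⇒same-edge P-x P-y _ ()
  opposite-sides⇒same-edge y-P x-P _ ()
  opposite-sides⇒same-edge y-P P-x () _
  opposite-sides⇒same-edge y-P y-P () _
  opposite-sides⇒same-edge P-y x-P () _
  opposite-sides⇒same-edge P-y P-x _ ()
  opposite-sides⇒same-edge P-y P-y () _

  data EdgeKind (u v : V) : Set where
    old-edge : ∀ a b → u ≡ old a → v ≡ old b → EdgeKind u v
    pendant-edge : ∀ t → u ≡ source t → v ≡ target t → EdgeKind u v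

  edgeKind : ∀ u v → G u v ≡ true → EdgeKind u v
  edgeKind zero v e = pendant-edge x-P refl (neighbour-0 v e)
  edgeKind (suc zero) v e = pendant-edge y-P refl (neighbour-1 v e)
  edgeKind (suc (suc a)) zero e = pendant-edge P-x (cong old (isP⇒≡ a e)) refl
  edgeKind (suc (suc a)) (suc zero) e = pendant-edge P-y (cong old (isP⇒≡ a e)) refl
  edgeKind (suc (suc a)) (suc (suc b)) e = old-edge a b refl refl

  cut-splits : ∀ u v → IsCutEdge G u v → SplitsLabels G lf u v
  cut-splits u v (e , ¬r) with edgeKind u v e
  ... | old-edge a b refl refl = T.SplitsLabels-toG a b (cutNonEmpty N₁' a b (from (T.IsCutEdge-embed⇔ a b) (e , ¬r)))
  ... | pendant-edge t refl refl = split (reflects-x t) (reflects-y t)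
    where
    split : ∀ {s} → Reflects (PendantSide t x) s → Reflects (PendantSide t y) (not s) → SplitsLabels G lf (source t) (target t)
    split (ofʸ r) (ofⁿ ¬r') = (x , r) , (y , ¬r')
    split (ofⁿ ¬r') (ofʸ r) = (y , r) , (x , ¬r')

  cut-distinct : ∀ u v u' v' → IsCutEdge G u v → IsCutEdge G u' v' →
                 SameSplit (Side G lf u v) (Side G lf u' v') → SamePair u v u' v'
  cut-distinct u v u' v' cut cut' split with edgeKind u v (proj₁ cut) | edgeKind u' v' (proj₁ cut')
  ... | old-edge a b refl refl | old-edge a' b' refl refl =
    T.SamePair-embed (cutDistinct N₁' a b a' b' (from (T.IsCutEdge-embed⇔ a b) cut) (from (T.IsCutEdge-embed⇔ a' b') cut')
                                  (T.SameSplit-toH a b a' b' split))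
  ... | old-edge a b refl refl | pendant-edge t refl refl =
    ⊥-elim (SameSplit-¬together-apart split (T.reach-x⇔reach-y a b) (reflects-x t) (reflects-y t))
  ... | pendant-edge t refl refl | old-edge a b refl refl =
    ⊥-elim (SameSplit-¬apart-together split (reflects-x t) (reflects-y t) (T.reach-x⇔reach-y a b))
  ... | pendant-edge t refl refl | pendant-edge t' refl refl with split
  ...   | inj₁ h = same-sides⇒same-edge t t' (Reflects-≡ (reflects-x t) (reflects-x t') (h x))
                                              (Reflects-≡ (reflects-w t) (reflects-w t') (h w))
  ...   | inj₂ h = opposite-sides⇒same-edge t t' (Reflects-≡not (reflects-x t) (reflects-x t') (h x))
                                                  (Reflects-≡not (reflects-w t) (reflects-w t') (h w))

  network : Network k (suc (suc m))
  network = record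
    { adj = G ; sym = G-sym ; irrefl = G-irrefl ; connected = G-connected ; atLeastTwo = atLeastTwo N
    ; leaf = lf ; leafInj = lf-injective ; leafDeg = lf-deg ; innerDeg = inner-deg
    ; cutNonEmpty = cut-splits ; cutDistinct = cut-distinct }

  reduction : CherryReduction network N₁'
  reduction = record
    { x = x ; y = y ; x≢y = x≢y ; p = P
    ; xp = GraphCherryReduction.xp graphReduction ; yp = GraphCherryReduction.yp graphReduction
    ; φ = old ; φInj = old-injective
    ; φImg = λ v → mk⇔ (image v) (λ (a , e) → old≢0 lf-x ∘ trans e , old≢1 lf-y ∘ trans e)
    ; φAdj = λ a b → refl ; z = z ; zLeaf = refl ; σ = σ ; σx = σx ; σy = σy
    ; σLeaf = λ a a≢z → sym (lf-σ a a≢z) ; σSurj = σSurj }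
    where
    image : ∀ v → (v ≢ lf x × v ≢ lf y) → ∃[ a ] old a ≡ v
    image zero (v≢x , _) = ⊥-elim (v≢x (sym lf-x))
    image (suc zero) (_ , v≢y) = ⊥-elim (v≢y (sym lf-y))
    image (suc (suc a)) _ = a , refl

  same : SameCherry C reduction
  same = record { x≡ = refl ; y≡ = refl ; z≡ = refl ; σ≡ = λ _ → refl }

-- Detaching a cherry
module DetachCherry {k n k₁ n₁ m} {N : Network k n} {N₁ : Network k₁ n₁}
                    (C : CherryReduction N N₁) (N' : Network k (suc (suc m)))
                    (p : Fin (suc (suc m)))
                    (xp : adj N' (leaf N' (CherryReduction.x C)) p ≡ true)
                    (yp : adj N' (leaf N' (CherryReduction.y C)) p ≡ true) where
  open CherryReduction C using (x; y; z; σ; x≢y; σx; σy; σSurj)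
  open NetworkFacts N'
  module A = CherryFacts C
  G : Adj (suc (suc m))
  G = adj N'

  lx ly : Fin (suc (suc m))
  lx = leaf N' x
  ly = leaf N' y

  lx≢ly : lx ≢ ly
  lx≢ly = leaf-≢ x≢y

  j : Fin (suc m)
  j = punchOut lx≢ly

  punchIn-j : punchIn lx j ≡ ly
  punchIn-j = punchIn-punchOut lx≢ly

  φ : Fin m → Fin (suc (suc m))
  φ a = punchIn lx (punchIn j a)

  φInj : ∀ a b → φ a ≡ φ b → a ≡ b
  φInj a b e = punchIn-injective j a b (punchIn-injective lx _ _ e)

  φ≢x : ∀ a → φ a ≢ lx
  φ≢x a = punchInᵢ≢i lx _

  φ≢y : ∀ a → φ a ≢ ly
  φ≢y a e = punchInᵢ≢i j a (punchIn-injective lx _ _ (trans e (sym punchIn-j)))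

  φ-onto : ∀ v → v ≢ lx → v ≢ ly → ∃[ a ] φ a ≡ v
  φ-onto v v≢x v≢y = punchOut j≢ , trans (cong (punchIn lx) (punchIn-punchOut j≢)) (punchIn-punchOut (v≢x ∘ sym))
    where
    j≢ : j ≢ punchOut (v≢x ∘ sym)
    j≢ e = v≢y (trans (sym (punchIn-punchOut (v≢x ∘ sym))) (trans (cong (punchIn lx) (sym e)) punchIn-j))

  H : Adj m
  H a b = G (φ a) (φ b)

  extension : PendantExtension G H
  extension = record { φ = φ ; φInj = φInj ; φAdj = λ a b → refl ; G-sym = Network.sym N' ; image⊎pendant = classify }
    where
    classify : ∀ v → (∃[ a ] φ a ≡ v) ⊎ AtMostOneNeighbour G v
    classify v with v ≟ lx
    ... | yes refl = inj₂ (leaf-pendant x)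
    ... | no v≢x with v ≟ ly
    ... | yes refl = inj₂ (leaf-pendant y)
    ... | no v≢y = inj₁ (φ-onto v v≢x v≢y)

  pH : Fin m
  pH = proj₁ (φ-onto p (adj⇒≢ xp ∘ sym) (adj⇒≢ yp ∘ sym))

  φ-pH : φ pH ≡ p
  φ-pH = proj₂ (φ-onto p (adj⇒≢ xp ∘ sym) (adj⇒≢ yp ∘ sym))

  2≤deg-p : 2 ≤ deg G p
  2≤deg-p = 2≤deg G p lx ly lx≢ly (trans (Network.sym N' p lx) xp) (trans (Network.sym N' p ly) yp)

  ¬2≤1 : ¬ (2 ≤ 1)
  ¬2≤1 (s≤s ())

  deg-p : deg G p ≡ 3
  deg-p = innerDeg N' p (λ d → ¬2≤1 (subst (2 ≤_) d 2≤deg-p))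

  deg-φ : ∀ a → deg G (φ a) ≡ indicator (G (φ a) lx) + (indicator (G (φ a) ly) + deg H a)
  deg-φ a = begin
    deg G (φ a)
      ≡⟨ deg≡sumFin G (φ a) ⟩
    sumFin (suc (suc m)) (indicator ∘ G (φ a))
      ≡⟨ sumFin-punchIn (suc m) lx (indicator ∘ G (φ a)) ⟩
    indicator (G (φ a) lx) + sumFin (suc m) (indicator ∘ G (φ a) ∘ punchIn lx)
      ≡⟨ cong (indicator (G (φ a) lx) +_) (sumFin-punchIn m j (indicator ∘ G (φ a) ∘ punchIn lx)) ⟩
    indicator (G (φ a) lx) + (indicator (G (φ a) (punchIn lx j)) + sumFin m (indicator ∘ H a))
      ≡⟨ cong (λ t → indicator (G (φ a) lx) + (indicator (G (φ a) t) + sumFin m (indicator ∘ H a))) punchIn-j ⟩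
    indicator (G (φ a) lx) + (indicator (G (φ a) ly) + sumFin m (indicator ∘ H a))
      ≡⟨ cong (λ t → indicator (G (φ a) lx) + (indicator (G (φ a) ly) + t)) (sym (deg≡sumFin H a)) ⟩
    indicator (G (φ a) lx) + (indicator (G (φ a) ly) + deg H a)
      ∎
    where open ≡-Reasoning

  ¬adj-leaf : ∀ a c → φ a ≢ p → adj N' (leaf N' c) p ≡ true → G (φ a) (leaf N' c) ≡ false
  ¬adj-leaf a c φa≢p cp = ¬-not (λ e → φa≢p (leaf-pendant c (φ a) p (trans (Network.sym N' _ (φ a)) e) cp))

  deg-φ-≢p : ∀ a → φ a ≢ p → deg H a ≡ deg G (φ a)
  deg-φ-≢p a φa≢p rewrite deg-φ a | ¬adj-leaf a x φa≢p xp | ¬adj-leaf a y φa≢p yp = refl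

  deg-pH : deg H pH ≡ 1
  deg-pH = cong (pred ∘ pred) (trans (sym (by-deg-φ)) (trans (cong (deg G) φ-pH) deg-p))
    where
    by-deg-φ : deg G (φ pH) ≡ suc (suc (deg H pH))
    by-deg-φ rewrite deg-φ pH | φ-pH | trans (Network.sym N' p lx) xp | trans (Network.sym N' p ly) yp = refl

  p≢leaf : ∀ c → p ≢ leaf N' c
  p≢leaf c e = ¬2≤1 (subst (2 ≤_) (trans (cong (deg G) e) (leaf-deg≡1 c)) 2≤deg-p)

  σ-leaf-preimage : ∀ a → a ≢ z → ∃[ b ] φ b ≡ leaf N' (σ a)
  σ-leaf-preimage a a≢z = φ-onto (leaf N' (σ a)) (leaf-≢ (σx a a≢z)) (leaf-≢ (σy a a≢z))

  leafAt : ∀ c → Dec (c ≡ z) → Fin m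
  leafAt c (yes _) = pH
  leafAt c (no c≢z) = proj₁ (σ-leaf-preimage c c≢z)

  lH : Fin k₁ → Fin m
  lH c = leafAt c (c ≟ z)

  φ-lH-z : φ (lH z) ≡ p
  φ-lH-z = by-cases (z ≟ z)
    where
    by-cases : ∀ d → φ (leafAt z d) ≡ p
    by-cases (yes _) = φ-pH
    by-cases (no z≢z) = ⊥-elim (z≢z refl)

  φ-lH-σ : ∀ a → a ≢ z → φ (lH a) ≡ leaf N' (σ a)
  φ-lH-σ a a≢z = by-cases (a ≟ z)
    where
    by-cases : ∀ d → φ (leafAt a d) ≡ leaf N' (σ a)
    by-cases (yes a≡z) = ⊥-elim (a≢z a≡z)
    by-cases (no a≢z') = proj₂ (σ-leaf-preimage a a≢z')

  lH-injective : ∀ a b → lH a ≡ lH b → a ≡ b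
  lH-injective a b e with a ≟ z | b ≟ z | φ-lH-σ a | φ-lH-σ b
  ... | yes refl | yes refl | _ | _ = refl
  ... | yes refl | no b≢z | _ | φ-b = ⊥-elim (p≢leaf _ (trans (sym φ-pH) (trans (cong φ e) (φ-b b≢z))))
  ... | no a≢z | yes refl | φ-a | _ = ⊥-elim (p≢leaf _ (trans (sym φ-pH) (trans (cong φ (sym e)) (φ-a a≢z))))
  ... | no a≢z | no b≢z | φ-a | φ-b =
    A.σInj a b a≢z b≢z (leafInj N' _ _ (trans (sym (φ-a a≢z)) (trans (cong φ e) (φ-b b≢z))))

  φ≡p⇒≡pH : ∀ {a} → φ a ≡ p → a ≡ pH
  φ≡p⇒≡pH e = φInj _ _ (trans e (sym φ-pH))

  lH-deg : ∀ a → (deg H a ≡ 1) ⇔ (∃[ c ] lH c ≡ a)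
  lH-deg a with φ a ≟ p
  ... | yes φa≡p rewrite φ≡p⇒≡pH φa≡p = mk⇔ (λ _ → z , φInj _ _ (trans φ-lH-z (sym φ-pH))) (λ _ → deg-pH)
  ... | no φa≢p = mk⇔ forward backward
    where
    forward : deg H a ≡ 1 → ∃[ c ] lH c ≡ a
    forward d with to (leafDeg N' (φ a)) (trans (sym (deg-φ-≢p a φa≢p)) d)
    ... | c , e with A.labelView c
    ...   | A.is-x refl = ⊥-elim (φ≢x a (sym e))
    ...   | A.is-y refl = ⊥-elim (φ≢y a (sym e))
    ...   | A.is-σ c' c'≢z refl = c' , φInj _ _ (trans (φ-lH-σ c' c'≢z) e)
    backward : ∃[ c ] lH c ≡ a → deg H a ≡ 1
    backward (c , lHc≡a) = by-cases (c ≟ z)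
      where
      by-cases : Dec (c ≡ z) → deg H a ≡ 1
      by-cases (yes refl) = ⊥-elim (φa≢p (trans (cong φ (sym lHc≡a)) φ-lH-z))
      by-cases (no c≢z) = trans (deg-φ-≢p a φa≢p)
                            (from (leafDeg N' (φ a)) (σ c , trans (sym (φ-lH-σ c c≢z)) (cong φ lHc≡a)))

  inner-deg : ∀ a → deg H a ≢ 1 → deg H a ≡ 3
  inner-deg a d≢1 with φ a ≟ p
  ... | yes φa≡p rewrite φ≡p⇒≡pH φa≡p = ⊥-elim (d≢1 deg-pH)
  ... | no φa≢p = trans (deg-φ-≢p a φa≢p) (innerDeg N' (φ a) (d≢1 ∘ trans (deg-φ-≢p a φa≢p)))

  labelCases : ∀ c → A.LabelView c → (c ≡ x) ⊎ ((c ≡ y) ⊎ (∃[ a ] (a ≢ z × σ a ≡ c)))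
  labelCases c (A.is-x e) = inj₁ e
  labelCases c (A.is-y e) = inj₂ (inj₁ e)
  labelCases c (A.is-σ a a≢z e) = inj₂ (inj₂ (a , a≢z , e))

  graphReduction : GraphCherryReduction k k₁ G H
  graphReduction = record
    { extension = extension ; lG = leaf N' ; lH = lH ; x = x ; y = y ; z = z ; σ = σ ; p = p
    ; x-pendant = leaf-pendant x ; y-pendant = leaf-pendant y ; xp = xp ; yp = yp
    ; zLeaf = φ-lH-z ; σLeaf = φ-lH-σ ; labelCases = λ c → labelCases c (A.labelView c)
    ; φ≢x = φ≢x ; φ≢y = φ≢y }

  module T = CutEdgeTransfer graphReduction

  network : Network k₁ m
  network = record
    { adj = H ; sym = λ a b → Network.sym N' (φ a) (φ b) ; irrefl = λ a → irrefl N' (φ a)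
    ; connected = λ a b → from (Reach-embed⇔ extension a b) (connected N' (φ a) (φ b))
    ; atLeastTwo = atLeastTwo N₁
    ; leaf = lH ; leafInj = lH-injective ; leafDeg = lH-deg ; innerDeg = inner-deg
    ; cutNonEmpty = λ a b cut → T.SplitsLabels-toH a b (cutNonEmpty N' (φ a) (φ b) (to (T.IsCutEdge-embed⇔ a b) cut))
    ; cutDistinct = λ a b a' b' cut cut' split →
        T.SamePair-unembed (cutDistinct N' _ _ _ _ (to (T.IsCutEdge-embed⇔ a b) cut) (to (T.IsCutEdge-embed⇔ a' b') cut')
                                        (T.SameSplit-toG a b a' b' split)) }

  reduction : CherryReduction N' network
  reduction = record
    { x = x ; y = y ; x≢y = x≢y ; p = p ; xp = xp ; yp = yp
    ; φ = φ ; φInj = φInj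
    ; φImg = λ v → mk⇔ (λ (v≢x , v≢y) → φ-onto v v≢x v≢y)
                       (λ (a , e) → φ≢x a ∘ trans e , φ≢y a ∘ trans e)
    ; φAdj = λ a b → refl ; z = z ; zLeaf = φ-lH-z ; σ = σ ; σx = σx ; σy = σy
    ; σLeaf = φ-lH-σ ; σSurj = σSurj }

  same : SameCherry C reduction
  same = record { x≡ = refl ; y≡ = refl ; z≡ = refl ; σ≡ = λ _ → refl }

Reconstructible-cherryReduction : ∀ {k n k₁ n₁} {N : Network k n} {N₁ : Network k₁ n₁} →
                                  CherryReduction N N₁ → Reconstructible N ⇔ Reconstructible N₁
Reconstructible-cherryReduction {k} {N = N} {N₁} C = mk⇔ restrict extend
  where
  open CherryReduction C using (x; y; x≢y)
  restrict : Reconstructible N → Reconstructible N₁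
  restrict rec-N N₁' D≡ = Iso-restrict E.same (rec-N E.network (SameDistMatrix-expand E.same D≡))
    where module E = AttachCherry C N₁'
  extend-via : ∀ {n'} (N' : Network k n') → SameDistMatrix N N' → ∀ {j} →
               Walk (adj N') (leaf N' x) (leaf N' y) j → j ≡ 2 → Reconstructible N₁ → Iso N N'
  extend-via {zero} N' _ _ _ _ with leaf N' x
  ... | ()
  extend-via {suc zero} N' _ _ _ _ = ⊥-elim (x≢y (leafInj N' _ _ (Fin1-irrelevant (leaf N' x) (leaf N' y))))
    where
    Fin1-irrelevant : ∀ (a b : Fin 1) → a ≡ b
    Fin1-irrelevant zero zero = refl
  extend-via {suc (suc m)} N' D≡ (step {_} {p} xp (step py here)) refl rec-N₁ =
    Iso-extend D.same (rec-N₁ D.network (SameCherryFacts.SameDistMatrix-reduce D.same D≡))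
    where module D = DetachCherry C N' p xp (trans (Network.sym N' _ _) py)
  extend : Reconstructible N₁ → Reconstructible N
  extend rec-N₁ N' D≡ = extend-via N' D≡ (proj₁ d-xy) refl rec-N₁
    where
    d-xy : DistMatrix N' x y 2
    d-xy = to (D≡ x y 2) (from (CherryFacts.DistMatrix-xy⇔ C 2) refl)

Reconstructible-reduces : ∀ {k n k' n'} {N : Network k n} {R : Network k' n'} →
                          Reduces N R → Reconstructible N ⇔ Reconstructible R
Reconstructible-reduces done = ⇔.refl
Reconstructible-reduces (more C reduces) = Reconstructible-cherryReduction C ⟫ Reconstructible-reduces reduces

corollary1 : ∀ {k n k' n'} (N : Network k n) (R : Network k' n') →
             IsSubtreeReducedVersion N R →
             (Reconstructible N ⇔ Reconstructible R)
corollary1 N R (reduces , _) = Reconstructible-reduces reduces
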